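{- Let $w,w'$ be words with letters in $[n]$. If $\mathrm{rev}(w)$ and $\mathrm{rev}(w')$ are Knuth-equivalent, then $\rho(w)=\rho(w')$.
   Context: $\mathrm{rev}$ reverses a word. Two words are Knuth-equivalent if one can be transformed into the other by a sequence of elementary Knuth transformations on consecutive triples: $bac\leftrightarrow bca$ for $a<b\le c$, and $acb\leftrightarrow cab$ for $a\le b<c$. A tuple $B=(B_1,\dots,B_L)$ of subsets of $[n]$ is drawn with rows $1..L$ bottom to top and columns $1..n$ left to right (ball at $(r,j)$ iff $j\in B_r$). $\mathrm{cw}(B)$ records row numbers of balls scanning columns left to right, each column top to bottom. $\mathrm{Par}_i(w)$ writes "(" for each letter $i+1$ and ")" for each letter $i$ read left to right, matching iteratively when "(" is immediately followed by ")" or separated only by matched parentheses; a ball of row $i+1$ is unmatched above if its letter is unmatched in $\mathrm{Par}_i(\mathrm{cw}(B))$. $e_i^\star$ moves all balls of row $i+1$ unmatched above to row $i$ (same column). Operators compose right to left, $e^\star_{[a,b]}=e^\star_a\cdots e^\star_b$, and $\rho_N(B)=e^\star_{[1,L-1]}\cdots e^\star_{[1,1]}(B)$. For $w=w_1\cdots w_k$, $\rho(w)=\rho_N((\{w_1\},\dots,\{w_k\}))$, where trailing empty rows of the result are disregarded when comparing. -}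

module Defs where

open import Data.Nat using (ℕ; zero; suc; _∸_; _≟_)
open import Data.Bool using (Bool; true; false; if_then_else_; _∨_)
open import Data.Fin as Fin using (Fin)
open import Data.Fin.Subset using (Subset; ⁅_⁆; _∪_; _∩_; ∁; ⊥)
open import Data.Vec as Vec using (Vec; lookup)
open import Data.List using (List; []; _∷_; _++_; [_]; map; concatMap; reverse; zip; upTo; length; foldl; allFin)
open import Data.Product using (_×_; _,_; proj₁)
open import Relation.Nullary using (yes; no)
open import Relation.Binary.Construct.Closure.Equivalence using (EqClosure)

-- Knuth equivalence (letters in Fin n, ordered as in Data.Fin;
-- Fin n = {0..n-1} is order-isomorphic to [n] = {1..n}).

data KnuthStep {n : ℕ} : List (Fin n) → List (Fin n) → Set where
  kbac : ∀ (u v : List (Fin n)) (a b c : Fin n) → a Fin.< b → b Fin.≤ c →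
         KnuthStep (u ++ b ∷ a ∷ c ∷ v) (u ++ b ∷ c ∷ a ∷ v)
  kacb : ∀ (u v : List (Fin n)) (a b c : Fin n) → a Fin.≤ b → b Fin.< c →
         KnuthStep (u ++ a ∷ c ∷ b ∷ v) (u ++ c ∷ a ∷ b ∷ v)

KnuthEquiv : {n : ℕ} → List (Fin n) → List (Fin n) → Set
KnuthEquiv = EqClosure KnuthStep

-- Ball configurations: B = (B_1, …, B_L) as a list of subsets of the
-- columns Fin n; the list position p (0-based) holds row p+1.

Balls : ℕ → Set
Balls n = List (Subset n)

indexed : ∀ {n} → Balls n → List (ℕ × Subset n)
indexed B = zip (map suc (upTo (length B))) B

-- column word with each letter tagged by the column of its ball:
-- columns left to right, in each column rows top (L) to bottom (1).
cwTagged : ∀ {n} → Balls n → List (ℕ × Fin n)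
cwTagged {n} B =
  concatMap (λ j → concatMap (λ rS → if lookup (Data.Product.proj₂ rS) j
                                      then [ (proj₁ rS , j) ] else [])
                             (reverse (indexed B)))
            (allFin n)

cw : ∀ {n} → Balls n → List ℕ
cw B = map proj₁ (cwTagged B)

-- Par_i: "(" for letter i+1, ")" for letter i, other letters ignored.
-- Matching (iteratively cancelling "()" pairs separated only by matched
-- parentheses) is computed by the standard stack scan: a ")" matches the
-- nearest unmatched "(" to its left.
unmatchedGo : ∀ {n} → ℕ → List (Fin n) → List (ℕ × Fin n) → List (Fin n)
unmatchedGo i st [] = st
unmatchedGo i st ((r , j) ∷ xs) with r ≟ suc i
... | yes _ = unmatchedGo i (j ∷ st) xs
... | no _ with r ≟ i
...   | no _ = unmatchedGo i st xs
...   | yes _ with st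
...     | [] = unmatchedGo i [] xs
...     | _ ∷ st' = unmatchedGo i st' xs

unmatchedAbove : ∀ {n} → ℕ → Balls n → List (Fin n)
unmatchedAbove i B = unmatchedGo i [] (cwTagged B)

toSubset : ∀ {n} → List (Fin n) → Subset n
toSubset [] = ⊥
toSubset (j ∷ js) = ⁅ j ⁆ ∪ toSubset js

eStar : ∀ {n} → ℕ → Balls n → Balls n
eStar {n} i B = map move (indexed B)
  where
  U : Subset n
  U = toSubset (unmatchedAbove i B)
  move : ℕ × Subset n → Subset n
  move (r , S) with r ≟ suc i
  ... | yes _ = S ∩ ∁ U
  ... | no _ with r ≟ i
  ...   | yes _ = S ∪ U
  ...   | no _ = S

eInterval : ∀ {n} → ℕ → Balls n → Balls n
eInterval zero B = B
eInterval (suc m) B = eInterval m (eStar (suc m) B)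

ρN : ∀ {n} → Balls n → Balls n
ρN B = foldl (λ C m → eInterval m C) B (map suc (upTo (length B ∸ 1)))

ρ : ∀ {n} → List (Fin n) → Balls n
ρ w = ρN (map ⁅_⁆ w)

nonempty : ∀ {m} → Vec Bool m → Bool
nonempty Vec.[] = false
nonempty (x Vec.∷ xs) = x ∨ nonempty xs

dropEmpty : ∀ {n} → Balls n → Balls n
dropEmpty [] = []
dropEmpty (S ∷ Bs) = if nonempty S then S ∷ Bs else dropEmpty Bs

stripTrailing : ∀ {n} → Balls n → Balls n
stripTrailing B = reverse (dropEmpty (reverse B))

{-# OPTIONS --safe #-}

-- ρ is computed letter by letter: appending x to w puts the ball x on a new top row, and
-- e⋆₁ ⋯ e⋆_L lets it sink. The configurations that arise are of highest weight (every row
-- dominates the row above it), and there each e⋆ᵢ moves at most one ball. Such a configuration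
-- is encoded by a tableau with weakly decreasing rows: its first row lists the largest ball of
-- every row, the next one the largest of the remaining balls, and so on. Under this encoding
-- the sinking of x is row insertion of x, and the tableau determines the configuration.
-- Finally, inserting the two sides of a Knuth relation into a weakly decreasing row gives the
-- same row and bumps out equal or again Knuth-related triples, so the tableau, and hence ρ,
-- only depends on the Knuth class of the reversed word.
module Submission where

open import Defs
open import Data.Bool using (Bool; true; false; _∧_; not; if_then_else_)
open import Data.Bool.Properties using (∧-identityʳ; ∨-identityʳ)
open import Data.Empty using (⊥-elim)
open import Data.Fin using (Fin; zero; suc; toℕ)
open import Data.Fin.Properties using (toℕ<n)
open import Data.Fin.Subset using (Subset; ⊥; ⁅_⁆; _∪_; _∩_; ∁)
open import Data.Fin.Subset.Properties using (∪-identityʳ; ∪-identityˡ; ∪-assoc; ∩-inverseʳ)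
open import Data.List using (List; []; _∷_; _++_; _∷ʳ_; map; concatMap; reverse; zip; length; drop; applyUpTo; upTo; foldl; tabulate; allFin)
open import Data.List.Properties using (∷-injective; ∷-injectiveˡ; ∷-injectiveʳ; ∷ʳ-injectiveˡ; ++-assoc; ++-identityʳ; drop-[])
open import Data.List.Properties using (map-++; map-cong; length-map; length-++; upTo-∷ʳ; foldl-∷ʳ; foldl-++)
open import Data.List.Properties using (concatMap-cong; concatMap-++; map-concatMap; unfold-reverse; reverse-map; reverse-++; reverse-involutive)
open import Data.List.Relation.Unary.All using (All; []; _∷_)
import Data.List.Relation.Unary.All as All
import Data.List.Relation.Unary.All.Properties as All
open import Data.List.Relation.Unary.AllPairs using (AllPairs; []; _∷_)
open import Data.List.Relation.Unary.Linked using (Linked; []; [-]; _∷_)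
import Data.List.Relation.Unary.Linked as Linked
import Data.List.Relation.Unary.Linked.Properties as Linked
open import Data.List.Reverse using (Reverse; reverseView; []; _∶_∶ʳ_)
open import Data.Nat
open import Data.Nat.Properties
open import Data.Product using (_×_; _,_; proj₁; proj₂)
open import Data.Sum using (_⊎_; inj₁; inj₂)
open import Data.Vec as Vec using (Vec; []; _∷_; lookup)
open import Function using (_∘_; id; flip; case_of_)
import Relation.Binary.Construct.Closure.Equivalence as EqClosure
open import Relation.Binary.Construct.Closure.Symmetric as SymClosure using (SymClosure; fwd; bwd)
open import Relation.Binary.Definitions using (tri<; tri≈; tri>)
open import Relation.Binary.PropositionalEquality
open import Relation.Nullary using (yes; no)
open import Relation.Nullary.Reflects using (ofʸ; ofⁿ)
module SuffixCounts where

  bit : Bool → ℕ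
  bit true  = 1
  bit false = 0

  bit≤1 : ∀ b → bit b ≤ 1
  bit≤1 true  = ≤-refl
  bit≤1 false = z≤n

  bit-injective : ∀ {a b} → bit a ≡ bit b → a ≡ b
  bit-injective {true}  {true}  _ = refl
  bit-injective {false} {false} _ = refl

  member : ∀ {n} → Subset n → ℕ → Bool
  member []      k       = false
  member (b ∷ A) zero    = b
  member (b ∷ A) (suc k) = member A k

  count≥ : ∀ {n} → Subset n → ℕ → ℕ
  count≥ []      t       = 0
  count≥ (b ∷ A) zero    = bit b + count≥ A zero
  count≥ (b ∷ A) (suc t) = count≥ A t

  count≥-step : ∀ {n} (A : Subset n) k → count≥ A k ≡ bit (member A k) + count≥ A (suc k)
  count≥-step []      k       = refl
  count≥-step (b ∷ A) zero    = refl
  count≥-step (b ∷ A) (suc k) = count≥-step A k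

  count≥-antitone : ∀ {n} (A : Subset n) {t t′} → t ≤ t′ → count≥ A t′ ≤ count≥ A t
  count≥-antitone []      _                  = z≤n
  count≥-antitone (b ∷ A) {t′ = zero}  z≤n   = ≤-refl
  count≥-antitone (b ∷ A) {t′ = suc _} z≤n   = ≤-trans (count≥-antitone A z≤n) (m≤n+m _ (bit b))
  count≥-antitone (b ∷ A) (s≤s t≤t′)         = count≥-antitone A t≤t′

  count≥≤n : ∀ {n} (A : Subset n) t → count≥ A t ≤ n
  count≥≤n []      t       = z≤n
  count≥≤n (b ∷ A) zero    = +-mono-≤ (bit≤1 b) (count≥≤n A zero)
  count≥≤n (b ∷ A) (suc t) = m≤n⇒m≤1+n (count≥≤n A t)

  count≥-injective : ∀ {n} (A B : Subset n) → (∀ t → count≥ A t ≡ count≥ B t) → A ≡ B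
  count≥-injective []      []      _ = refl
  count≥-injective (a ∷ A) (b ∷ B) h with count≥-injective A B (h ∘ suc)
  ... | refl = cong (_∷ A) (bit-injective (+-cancelʳ-≡ (count≥ A 0) (bit a) (bit b) (h 0)))

  count≥-∈ : ∀ {n} (A : Subset n) k → member A k ≡ true → count≥ A k ≡ suc (count≥ A (suc k))
  count≥-∈ A k k∈A rewrite count≥-step A k | k∈A = refl

  count≥-∉ : ∀ {n} (A : Subset n) k → member A k ≡ false → count≥ A k ≡ count≥ A (suc k)
  count≥-∉ A k k∉A rewrite count≥-step A k | k∉A = refl

  count≥⇒∈ : ∀ {n} (A : Subset n) k → count≥ A k ≡ suc (count≥ A (suc k)) → member A k ≡ true
  count≥⇒∈ A k eq with member A k in k∈?A
  ... | true  = refl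
  ... | false = ⊥-elim (1+n≢n (sym (trans (sym (count≥-∉ A k k∈?A)) eq)))

  count≥⇒∉ : ∀ {n} (A : Subset n) k → count≥ A k ≡ count≥ A (suc k) → member A k ≡ false
  count≥⇒∉ A k eq with member A k in k∈?A
  ... | false = refl
  ... | true  = ⊥-elim (1+n≢n (sym (trans (sym eq) (count≥-∈ A k k∈?A))))

  ∈⇒count≥0>0 : ∀ {n} (A : Subset n) k → member A k ≡ true → 0 < count≥ A 0
  ∈⇒count≥0>0 A       zero    k∈A rewrite count≥-step A 0 | k∈A = z<s
  ∈⇒count≥0>0 (b ∷ A) (suc k) k∈A = ≤-trans (∈⇒count≥0>0 A k k∈A) (m≤n+m _ (bit b))

  member⇒< : ∀ {n} (A : Subset n) k → member A k ≡ true → k < n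
  member⇒< (b ∷ A) zero    _   = z<s
  member⇒< (b ∷ A) (suc k) k∈A = s<s (member⇒< A k k∈A)

  𝟙< : ℕ → ℕ → ℕ
  𝟙< t       zero    = 0
  𝟙< zero    (suc v) = 1
  𝟙< (suc t) (suc v) = 𝟙< t v

  𝟙<≡1 : ∀ {t v} → t < v → 𝟙< t v ≡ 1
  𝟙<≡1 {zero}  {suc v} _         = refl
  𝟙<≡1 {suc t} {suc v} (s≤s t<v) = 𝟙<≡1 t<v

  𝟙<≡0 : ∀ {t v} → v ≤ t → 𝟙< t v ≡ 0
  𝟙<≡0 {t}     {zero}  _         = refl
  𝟙<≡0 {suc t} {suc v} (s≤s v≤t) = 𝟙<≡0 v≤t

  𝟙<≤1 : ∀ t v → 𝟙< t v ≤ 1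
  𝟙<≤1 t       zero    = z≤n
  𝟙<≤1 zero    (suc v) = ≤-refl
  𝟙<≤1 (suc t) (suc v) = 𝟙<≤1 t v

  -- Letters are naturals: the letter suc j is the column j, and 0 is "no letter".
  ⟦_⟧ : ∀ {n} → ℕ → Subset n
  ⟦ zero ⟧                   = ⊥
  ⟦_⟧ {zero}  (suc v)       = []
  ⟦_⟧ {suc n} (suc zero)    = true ∷ ⊥
  ⟦_⟧ {suc n} (suc (suc v)) = false ∷ ⟦ suc v ⟧

  count≥-⊥ : ∀ {n} t → count≥ (⊥ {n}) t ≡ 0
  count≥-⊥ {zero}  t       = refl
  count≥-⊥ {suc n} zero    = count≥-⊥ {n} zero
  count≥-⊥ {suc n} (suc t) = count≥-⊥ {n} t

  count≥-⟦⟧ : ∀ {n} v t → v ≤ n → count≥ (⟦_⟧ {n} v) t ≡ 𝟙< t v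
  count≥-⟦⟧ {n}     zero          t       _         = count≥-⊥ {n} t
  count≥-⟦⟧ {suc n} (suc zero)    zero    _         = cong suc (count≥-⊥ {n} zero)
  count≥-⟦⟧ {suc n} (suc zero)    (suc t) _         = count≥-⊥ {n} t
  count≥-⟦⟧ {suc n} (suc (suc v)) zero    (s≤s v<n) = count≥-⟦⟧ (suc v) zero v<n
  count≥-⟦⟧ {suc n} (suc (suc v)) (suc t) (s≤s v<n) = count≥-⟦⟧ (suc v) t v<n

  A∩∁⊥≡A : ∀ {n} (A : Subset n) → A ∩ ∁ ⊥ ≡ A
  A∩∁⊥≡A []      = refl
  A∩∁⊥≡A (a ∷ A) = cong₂ _∷_ (∧-identityʳ a) (A∩∁⊥≡A A)

  count≥-∪⟦suc⟧ : ∀ {n} (A : Subset n) k → member A k ≡ false → suc k ≤ n →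
                  ∀ t → count≥ (A ∪ ⟦ suc k ⟧) t ≡ count≥ A t + 𝟙< t (suc k)
  count≥-∪⟦suc⟧ (a ∷ A) zero k∉A _ zero
    rewrite k∉A | ∪-identityʳ A = +-comm 1 (count≥ A 0)
  count≥-∪⟦suc⟧ (a ∷ A) zero _ _ (suc t)
    rewrite ∪-identityʳ A = sym (+-identityʳ _)
  count≥-∪⟦suc⟧ (a ∷ A) (suc k) k∉A (s≤s k<n) zero
    rewrite count≥-∪⟦suc⟧ A k k∉A k<n zero | ∨-identityʳ a = sym (+-assoc (bit a) (count≥ A 0) 1)
  count≥-∪⟦suc⟧ (a ∷ A) (suc k) k∉A (s≤s k<n) (suc t) = count≥-∪⟦suc⟧ A k k∉A k<n t

  count≥-∖⟦suc⟧ : ∀ {n} (A : Subset n) k → member A k ≡ true →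
                  ∀ t → count≥ (A ∩ ∁ ⟦ suc k ⟧) t ≡ count≥ A t ∸ 𝟙< t (suc k)
  count≥-∖⟦suc⟧ (a ∷ A) zero    k∈A zero    rewrite k∈A | A∩∁⊥≡A A = refl
  count≥-∖⟦suc⟧ (a ∷ A) zero    _   (suc t) rewrite A∩∁⊥≡A A = refl
  count≥-∖⟦suc⟧ (a ∷ A) (suc k) k∈A zero
    rewrite count≥-∖⟦suc⟧ A k k∈A zero | ∧-identityʳ a | 𝟙<≡1 {0} {suc k} z<s =
    sym (+-∸-assoc (bit a) (∈⇒count≥0>0 A k k∈A))
  count≥-∖⟦suc⟧ (a ∷ A) (suc k) k∈A (suc t) = count≥-∖⟦suc⟧ A k k∈A t

  count≥-∪⟦⟧ : ∀ {n} (A : Subset n) v → v ≤ n → (∀ k → v ≡ suc k → member A k ≡ false) →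
               ∀ t → count≥ (A ∪ ⟦ v ⟧) t ≡ count≥ A t + 𝟙< t v
  count≥-∪⟦⟧ A zero    _   _   t rewrite ∪-identityʳ A = sym (+-identityʳ _)
  count≥-∪⟦⟧     A (suc k) v≤n v∉A t = count≥-∪⟦suc⟧ A k (v∉A k refl) v≤n t

  count≥-∖⟦⟧ : ∀ {n} (A : Subset n) v → (∀ k → v ≡ suc k → member A k ≡ true) →
               ∀ t → count≥ (A ∩ ∁ ⟦ v ⟧) t ≡ count≥ A t ∸ 𝟙< t v
  count≥-∖⟦⟧ A zero    _   t rewrite A∩∁⊥≡A A = refl
  count≥-∖⟦⟧ A (suc k) v∈A t = count≥-∖⟦suc⟧ A k (v∈A k refl) t

  extendLast : ℕ → Bool → ℕ
  extendLast zero    b = bit b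
  extendLast (suc s) _ = suc (suc s)

  -- The largest element of A as a letter, 0 if A is empty.
  top : ∀ {n} → Subset n → ℕ
  top []      = 0
  top (b ∷ A) = extendLast (top A) b

  top≤⇒count≥≡0 : ∀ {n} (A : Subset n) t → top A ≤ t → count≥ A t ≡ 0
  top≤⇒count≥≡0 []      t h = refl
  top≤⇒count≥≡0 (b ∷ A) t h with top A in e
  top≤⇒count≥≡0 (false ∷ A) zero    h       | zero  = top≤⇒count≥≡0 A zero (≤-reflexive e)
  top≤⇒count≥≡0 (true  ∷ A) zero    ()      | zero
  top≤⇒count≥≡0 (b     ∷ A) (suc t) h       | zero  = top≤⇒count≥≡0 A t (subst (_≤ t) (sym e) z≤n)
  top≤⇒count≥≡0 (b     ∷ A) (suc t) (s≤s h) | suc k = top≤⇒count≥≡0 A t (subst (_≤ t) (sym e) h)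

  <top⇒count≥>0 : ∀ {n} (A : Subset n) t → t < top A → 0 < count≥ A t
  <top⇒count≥>0 (b ∷ A) t h with top A in e
  <top⇒count≥>0 (true  ∷ A) zero    h       | zero  = z<s
  <top⇒count≥>0 (true  ∷ A) (suc t) (s≤s ()) | zero
  <top⇒count≥>0 (b     ∷ A) zero    h       | suc k =
    ≤-trans (<top⇒count≥>0 A zero (subst (0 <_) (sym e) z<s)) (m≤n+m _ (bit b))
  <top⇒count≥>0 (b     ∷ A) (suc t) (s≤s h) | suc k = <top⇒count≥>0 A t (subst (t <_) (sym e) h)

  count≥≡0⇒top≤ : ∀ {n} (A : Subset n) t → count≥ A t ≡ 0 → top A ≤ t
  count≥≡0⇒top≤ A t eq = ≮⇒≥ (λ t<top → <⇒≢ (<top⇒count≥>0 A t t<top) (sym eq))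

  top-unique : ∀ {n} (A : Subset n) z → (∀ t → count≥ A t ≡ 0 → z ≤ t) → (∀ t → z ≤ t → count≥ A t ≡ 0) →
               top A ≡ z
  top-unique A z zero⇒z≤ z≤⇒zero =
    ≤-antisym (count≥≡0⇒top≤ A z (z≤⇒zero z ≤-refl)) (zero⇒z≤ (top A) (top≤⇒count≥≡0 A (top A) ≤-refl))

  top≤n : ∀ {n} (A : Subset n) → top A ≤ n
  top≤n []      = z≤n
  top≤n (b ∷ A) with top A | top≤n A
  ... | zero  | _ = ≤-trans (bit≤1 b) (s≤s z≤n)
  ... | suc k | h = s≤s h

  top≡suc⇒∈ : ∀ {n} (A : Subset n) k → top A ≡ suc k → member A k ≡ true
  top≡suc⇒∈ A k e with member A k in k∈?A
  ... | true  = refl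
  ... | false = ⊥-elim (<⇒≢ (<top⇒count≥>0 A k (subst (k <_) (sym e) ≤-refl)) (sym (begin
    count≥ A k       ≡⟨ count≥-∉ A k k∈?A ⟩
    count≥ A (suc k) ≡⟨ top≤⇒count≥≡0 A (suc k) (≤-reflexive e) ⟩
    0                ∎)))
    where open ≡-Reasoning

  top≤⇒∉ : ∀ {n} (A : Subset n) k → top A ≤ k → member A k ≡ false
  top≤⇒∉ A k h = count≥⇒∉ A k (trans (top≤⇒count≥≡0 A k h) (sym (top≤⇒count≥≡0 A (suc k) (m≤n⇒m≤1+n h))))

  dropTop : ∀ {n} → Subset n → Subset n
  dropTop []      = []
  dropTop (b ∷ A) with top A
  ... | zero  = false ∷ A
  ... | suc _ = b ∷ dropTop A

  count≥-dropTop : ∀ {n} (A : Subset n) t → count≥ (dropTop A) t ≡ count≥ A t ∸ 1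
  count≥-dropTop []      t = refl
  count≥-dropTop (b ∷ A) t with top A in e
  count≥-dropTop (b ∷ A) zero    | zero
    rewrite top≤⇒count≥≡0 A zero (≤-reflexive e) | +-identityʳ (bit b) = sym (m≤n⇒m∸n≡0 (bit≤1 b))
  count≥-dropTop (b ∷ A) (suc t) | zero
    rewrite top≤⇒count≥≡0 A t (subst (_≤ t) (sym e) z≤n) = refl
  count≥-dropTop (b ∷ A) zero    | suc k
    rewrite count≥-dropTop A zero = sym (+-∸-assoc (bit b) (<top⇒count≥>0 A zero (subst (0 <_) (sym e) z<s)))
  count≥-dropTop (b ∷ A) (suc t) | suc k = count≥-dropTop A t

  infix 4 _≼_
  _≼_ : ∀ {n} → Subset n → Subset n → Set
  C ≼ D = ∀ t → count≥ C t ≤ count≥ D t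

  -- One plus the largest t with count≥ D t < count≥ Y t, or 0 if Y ≼ D.
  violation : ∀ {n} → Subset n → Subset n → ℕ
  violation []      []      = 0
  violation (y ∷ Y) (d ∷ D) = extendLast (violation Y D) (count≥ (d ∷ D) 0 <ᵇ count≥ (y ∷ Y) 0)

  violation≡0⇒≼ : ∀ {n} (Y D : Subset n) → violation Y D ≡ 0 → Y ≼ D
  violation≡0⇒≼ []      []      _ t = z≤n
  violation≡0⇒≼ (y ∷ Y) (d ∷ D) h t
    with violation Y D in e | count≥ (d ∷ D) 0 <ᵇ count≥ (y ∷ Y) 0 | <ᵇ-reflects-< (count≥ (d ∷ D) 0) (count≥ (y ∷ Y) 0)
  violation≡0⇒≼ (y ∷ Y) (d ∷ D) h zero    | zero | false | ofⁿ ¬lt = ≮⇒≥ ¬lt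
  violation≡0⇒≼ (y ∷ Y) (d ∷ D) h (suc t) | zero | false | ofⁿ _   = violation≡0⇒≼ Y D e t

  violation≡suc : ∀ {n} (Y D : Subset n) s → violation Y D ≡ suc s →
                  count≥ D s < count≥ Y s × (∀ t → s < t → count≥ Y t ≤ count≥ D t)
  violation≡suc []      []      s ()
  violation≡suc (y ∷ Y) (d ∷ D) s h
    with violation Y D in e | count≥ (d ∷ D) 0 <ᵇ count≥ (y ∷ Y) 0 | <ᵇ-reflects-< (count≥ (d ∷ D) 0) (count≥ (y ∷ Y) 0)
  violation≡suc (y ∷ Y) (d ∷ D) .(suc s′) refl | suc s′ | _ | _ = lt , above
    where
    lt,above = violation≡suc Y D s′ e
    lt = proj₁ lt,above
    above : ∀ t → suc s′ < t → count≥ (y ∷ Y) t ≤ count≥ (d ∷ D) t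
    above (suc t) (s≤s s′<t) = proj₂ lt,above t s′<t
  violation≡suc (y ∷ Y) (d ∷ D) .zero refl | zero | true | ofʸ lt = lt , above
    where
    above : ∀ t → 0 < t → count≥ (y ∷ Y) t ≤ count≥ (d ∷ D) t
    above (suc t) _ = violation≡0⇒≼ Y D e t

  ≼⇒violation≡0 : ∀ {n} (Y D : Subset n) → Y ≼ D → violation Y D ≡ 0
  ≼⇒violation≡0 []      []      _   = refl
  ≼⇒violation≡0 (y ∷ Y) (d ∷ D) Y≼D
    with violation Y D in e | count≥ (d ∷ D) 0 <ᵇ count≥ (y ∷ Y) 0 | <ᵇ-reflects-< (count≥ (d ∷ D) 0) (count≥ (y ∷ Y) 0)
  ... | suc s | _     | _      = ⊥-elim (<⇒≱ (proj₁ (violation≡suc Y D s e)) (Y≼D (suc s)))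
  ... | zero  | true  | ofʸ lt = ⊥-elim (<⇒≱ lt (Y≼D 0))
  ... | zero  | false | ofⁿ _  = refl

  violation-unique : ∀ {n} (Y D : Subset n) s → count≥ D s < count≥ Y s → (∀ t → s < t → count≥ Y t ≤ count≥ D t) →
                     violation Y D ≡ suc s
  violation-unique Y D s lt above with violation Y D in e
  ... | zero   = ⊥-elim (<⇒≱ lt (violation≡0⇒≼ Y D e s))
  ... | suc s′ with <-cmp s s′ | violation≡suc Y D s′ e
  ...   | tri< s<s′ _ _ | lt′ , _      = ⊥-elim (<⇒≱ lt′ (above s′ s<s′))
  ...   | tri≈ _ refl _ | _            = refl
  ...   | tri> _ _ s′<s | _ , above′   = ⊥-elim (<⇒≱ lt (above′ s s′<s))

  violation-cong : ∀ {n} (Y D Y′ D′ : Subset n) →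
                   (∀ t → count≥ D t < count≥ Y t → count≥ D′ t < count≥ Y′ t) →
                   (∀ t → count≥ D′ t < count≥ Y′ t → count≥ D t < count≥ Y t) →
                   violation Y D ≡ violation Y′ D′
  violation-cong Y D Y′ D′ to from with violation Y D in e
  ... | zero  = sym (≼⇒violation≡0 Y′ D′ (λ t → ≮⇒≥ (λ lt → <⇒≱ (from t lt) (violation≡0⇒≼ Y D e t))))
  ... | suc s = sym (violation-unique Y′ D′ s (to s lt)
                       (λ t s<t → ≮⇒≥ (λ lt′ → <⇒≱ (from t lt′) (above t s<t))))
    where
    lt = proj₁ (violation≡suc Y D s e)
    above = proj₂ (violation≡suc Y D s e)

  violation-top : ∀ {n} (Y D : Subset n) k → top Y ≡ suc k → top D ≤ k → violation Y D ≡ suc k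
  violation-top Y D k e D≤k = violation-unique Y D k lt
    (λ t k<t → subst (_≤ count≥ D t) (sym (top≤⇒count≥≡0 Y t (subst (_≤ t) (sym e) k<t))) z≤n)
    where
    lt : count≥ D k < count≥ Y k
    lt rewrite top≤⇒count≥≡0 D k D≤k = <top⇒count≥>0 Y k (subst (k <_) (sym e) ≤-refl)

  violation-∈∉ : ∀ {n} (Y D : Subset n) s → violation Y D ≡ suc s → member Y s ≡ true × member D s ≡ false
  violation-∈∉ Y D s e with violation≡suc Y D s e
  ... | lt , above with member Y s in s∈?Y | member D s in s∈?D
  ...   | true  | false = refl , refl
  ...   | true  | true  = ⊥-elim (<⇒≱ lt (begin
    count≥ Y s             ≡⟨ count≥-∈ Y s s∈?Y ⟩
    suc (count≥ Y (suc s)) ≤⟨ s≤s (above (suc s) ≤-refl) ⟩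
    suc (count≥ D (suc s)) ≡⟨ count≥-∈ D s s∈?D ⟨
    count≥ D s             ∎))
    where open ≤-Reasoning
  ...   | false | _     = ⊥-elim (<⇒≱ lt (begin
    count≥ Y s       ≡⟨ count≥-∉ Y s s∈?Y ⟩
    count≥ Y (suc s) ≤⟨ above (suc s) ≤-refl ⟩
    count≥ D (suc s) ≤⟨ count≥-antitone D (n≤1+n s) ⟩
    count≥ D s       ∎))
    where open ≤-Reasoning

  violation≤n : ∀ {n} (Y D : Subset n) v → violation Y D ≡ v → v ≤ n
  violation≤n Y D zero    _ = z≤n
  violation≤n Y D (suc s) e = member⇒< Y s (proj₁ (violation-∈∉ Y D s e))

  count≥-top∸1≤1 : ∀ {n} (A : Subset n) → count≥ A (top A ∸ 1) ≤ 1
  count≥-top∸1≤1 A with top A in e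
  ... | zero  = ≤-trans (≤-reflexive (top≤⇒count≥≡0 A 0 (≤-reflexive e))) z≤n
  ... | suc k = begin
    count≥ A k                            ≡⟨ count≥-step A k ⟩
    bit (member A k) + count≥ A (suc k)   ≡⟨ cong (bit (member A k) +_) (top≤⇒count≥≡0 A (suc k) (≤-reflexive e)) ⟩
    bit (member A k) + 0                  ≡⟨ +-identityʳ _ ⟩
    bit (member A k)                      ≤⟨ bit≤1 _ ⟩
    1                                     ∎
    where open ≤-Reasoning

  top-dropTop : ∀ {n} (A : Subset n) → top (dropTop A) ≤ top A ∸ 1
  top-dropTop A = count≥≡0⇒top≤ (dropTop A) (top A ∸ 1)
    (trans (count≥-dropTop A (top A ∸ 1)) (m≤n⇒m∸n≡0 (count≥-top∸1≤1 A)))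

  top<⇒∉ : ∀ {n} (A : Subset n) {v} → top A < v → ∀ k → v ≡ suc k → member A k ≡ false
  top<⇒∉ A lt k refl = top≤⇒∉ A k (≤-pred lt)

  ≼⇒top≤ : ∀ {n} (C D : Subset n) → C ≼ D → top C ≤ top D
  ≼⇒top≤ C D C≼D = count≥≡0⇒top≤ C (top D) (n≤0⇒n≡0 (≤-trans (C≼D (top D)) (≤-reflexive (top≤⇒count≥≡0 D (top D) ≤-refl))))

  dropTop-∪-top : ∀ {n} (A : Subset n) → dropTop A ∪ ⟦ top A ⟧ ≡ A
  dropTop-∪-top A = count≥-injective _ A counts
    where
    top∉dropTop : ∀ k → top A ≡ suc k → member (dropTop A) k ≡ false
    top∉dropTop k e = top≤⇒∉ (dropTop A) k (subst (λ z → top (dropTop A) ≤ z ∸ 1) e (top-dropTop A))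
    counts : ∀ t → count≥ (dropTop A ∪ ⟦ top A ⟧) t ≡ count≥ A t
    counts t rewrite count≥-∪⟦⟧ (dropTop A) (top A) (top≤n A) top∉dropTop t | count≥-dropTop A t
      with t <? top A
    ... | yes t<top rewrite 𝟙<≡1 t<top = m∸n+n≡m (<top⇒count≥>0 A t t<top)
    ... | no  t≮top rewrite 𝟙<≡0 (≮⇒≥ t≮top) | top≤⇒count≥≡0 A t (≮⇒≥ t≮top) = refl

  dropTop-∪⟦⟧ : ∀ {n} (A : Subset n) z → top A < z → z ≤ n → dropTop (A ∪ ⟦ z ⟧) ≡ A
  dropTop-∪⟦⟧ A z top<z z≤bound = count≥-injective _ A counts
    where
    counts : ∀ t → count≥ (dropTop (A ∪ ⟦ z ⟧)) t ≡ count≥ A t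
    counts t rewrite count≥-dropTop (A ∪ ⟦ z ⟧) t | count≥-∪⟦⟧ A z z≤bound (top<⇒∉ A top<z) t with t <? z
    ... | yes t<z rewrite 𝟙<≡1 t<z = m+n∸n≡m (count≥ A t) 1
    ... | no  t≮z rewrite 𝟙<≡0 (≮⇒≥ t≮z) | top≤⇒count≥≡0 A t (≤-trans (<⇒≤ top<z) (≮⇒≥ t≮z)) = refl

  top-∪⟦⟧ : ∀ {n} (A : Subset n) z → top A < z → z ≤ n → top (A ∪ ⟦ z ⟧) ≡ z
  top-∪⟦⟧ A z top<z z≤bound = top-unique (A ∪ ⟦ z ⟧) z zero⇒z≤ z≤⇒zero
    where
    counts = count≥-∪⟦⟧ A z z≤bound (top<⇒∉ A top<z)
    zero⇒z≤ : ∀ t → count≥ (A ∪ ⟦ z ⟧) t ≡ 0 → z ≤ t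
    zero⇒z≤ t eq = ≮⇒≥ (λ t<z → 1+n≢0 (begin
      suc (count≥ A t)       ≡⟨ +-comm 1 (count≥ A t) ⟩
      count≥ A t + 1         ≡⟨ cong (count≥ A t +_) (𝟙<≡1 t<z) ⟨
      count≥ A t + 𝟙< t z    ≡⟨ counts t ⟨
      count≥ (A ∪ ⟦ z ⟧) t   ≡⟨ eq ⟩
      0                      ∎))
      where open ≡-Reasoning
    z≤⇒zero : ∀ t → z ≤ t → count≥ (A ∪ ⟦ z ⟧) t ≡ 0
    z≤⇒zero t z≤t rewrite counts t | 𝟙<≡0 z≤t | top≤⇒count≥≡0 A t (≤-trans (<⇒≤ top<z) z≤t) = refl

  A∖top≡dropTop : ∀ {n} (A : Subset n) → A ∩ ∁ ⟦ top A ⟧ ≡ dropTop A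
  A∖top≡dropTop A = count≥-injective _ _ counts
    where
    counts : ∀ t → count≥ (A ∩ ∁ ⟦ top A ⟧) t ≡ count≥ (dropTop A) t
    counts t rewrite count≥-∖⟦⟧ A (top A) (top≡suc⇒∈ A) t | count≥-dropTop A t with t <? top A
    ... | yes t<top rewrite 𝟙<≡1 t<top = refl
    ... | no  t≮top rewrite 𝟙<≡0 (≮⇒≥ t≮top) | top≤⇒count≥≡0 A t (≮⇒≥ t≮top) = refl

  ∪⟦⟧∖⟦⟧ : ∀ {n} (A : Subset n) z → top A < z → z ≤ n → (A ∪ ⟦ z ⟧) ∩ ∁ ⟦ z ⟧ ≡ A
  ∪⟦⟧∖⟦⟧ A z top<z z≤bound = begin
    (A ∪ ⟦ z ⟧) ∩ ∁ ⟦ z ⟧                ≡⟨ cong (λ w → (A ∪ ⟦ z ⟧) ∩ ∁ ⟦ w ⟧) (top-∪⟦⟧ A z top<z z≤bound) ⟨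
    (A ∪ ⟦ z ⟧) ∩ ∁ ⟦ top (A ∪ ⟦ z ⟧) ⟧  ≡⟨ A∖top≡dropTop (A ∪ ⟦ z ⟧) ⟩
    dropTop (A ∪ ⟦ z ⟧)                  ≡⟨ dropTop-∪⟦⟧ A z top<z z≤bound ⟩
    A                                    ∎
    where open ≡-Reasoning

  top-⟦⟧ : ∀ {n} v → v ≤ n → top (⟦_⟧ {n} v) ≡ v
  top-⟦⟧ {n} v v≤n = top-unique ⟦ v ⟧ v zero⇒v≤ v≤⇒zero
    where
    zero⇒v≤ : ∀ t → count≥ (⟦_⟧ {n} v) t ≡ 0 → v ≤ t
    zero⇒v≤ t eq = ≮⇒≥ (λ t<v → 1+n≢0 (trans (sym (𝟙<≡1 t<v)) (trans (sym (count≥-⟦⟧ v t v≤n)) eq)))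
    v≤⇒zero : ∀ t → v ≤ t → count≥ (⟦_⟧ {n} v) t ≡ 0
    v≤⇒zero t v≤t = trans (count≥-⟦⟧ v t v≤n) (𝟙<≡0 v≤t)

  dropTop-⟦⟧ : ∀ {n} v → v ≤ n → dropTop (⟦_⟧ {n} v) ≡ ⊥
  dropTop-⟦⟧ {n} v v≤n = count≥-injective _ _ (λ t → begin
    count≥ (dropTop (⟦_⟧ {n} v)) t  ≡⟨ count≥-dropTop ⟦ v ⟧ t ⟩
    count≥ (⟦_⟧ {n} v) t ∸ 1        ≡⟨ cong (_∸ 1) (count≥-⟦⟧ v t v≤n) ⟩
    𝟙< t v ∸ 1                ≡⟨ m≤n⇒m∸n≡0 (𝟙<≤1 t v) ⟩
    0                         ≡⟨ count≥-⊥ {n} t ⟨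
    count≥ (⊥ {n}) t          ∎)
    where open ≡-Reasoning

  top≡0⇒dropTop≡id : ∀ {n} (A : Subset n) → top A ≡ 0 → dropTop A ≡ A
  top≡0⇒dropTop≡id A e = count≥-injective _ _ (λ t → begin
    count≥ (dropTop A) t  ≡⟨ count≥-dropTop A t ⟩
    count≥ A t ∸ 1        ≡⟨ cong (_∸ 1) (empty t) ⟩
    0                     ≡⟨ empty t ⟨
    count≥ A t            ∎)
    where
    open ≡-Reasoning
    empty : ∀ t → count≥ A t ≡ 0
    empty t = top≤⇒count≥≡0 A t (subst (_≤ t) (sym e) z≤n)

  ∉⇒∉dropTop : ∀ {n} (A : Subset n) s → member A s ≡ false → member (dropTop A) s ≡ false
  ∉⇒∉dropTop A s s∉A = count≥⇒∉ (dropTop A) s (begin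
    count≥ (dropTop A) s        ≡⟨ count≥-dropTop A s ⟩
    count≥ A s ∸ 1              ≡⟨ cong (_∸ 1) (count≥-∉ A s s∉A) ⟩
    count≥ A (suc s) ∸ 1        ≡⟨ count≥-dropTop A (suc s) ⟨
    count≥ (dropTop A) (suc s)  ∎)
    where open ≡-Reasoning

  ∈⇒∈dropTop : ∀ {n} (A : Subset n) s → suc s < top A → member A s ≡ true → member (dropTop A) s ≡ true
  ∈⇒∈dropTop A s s<top s∈A = count≥⇒∈ (dropTop A) s (begin
    count≥ (dropTop A) s              ≡⟨ count≥-dropTop A s ⟩
    count≥ A s ∸ 1                    ≡⟨ cong (_∸ 1) (count≥-∈ A s s∈A) ⟩
    count≥ A (suc s)                  ≡⟨ m∸n+n≡m (<top⇒count≥>0 A (suc s) s<top) ⟨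
    count≥ A (suc s) ∸ 1 + 1          ≡⟨ +-comm _ 1 ⟩
    suc (count≥ A (suc s) ∸ 1)        ≡⟨ cong suc (count≥-dropTop A (suc s)) ⟨
    suc (count≥ (dropTop A) (suc s))  ∎)
    where open ≡-Reasoning

  top-∪⟦⟧-below : ∀ {n} (D : Subset n) s → suc s < top D → member D s ≡ false → top (D ∪ ⟦ suc s ⟧) ≡ top D
  top-∪⟦⟧-below D s s<top s∉D = top-unique (D ∪ ⟦ suc s ⟧) (top D) zero⇒top≤ top≤⇒zero
    where
    counts = count≥-∪⟦suc⟧ D s s∉D (≤-trans (<⇒≤ s<top) (top≤n D))
    zero⇒top≤ : ∀ t → count≥ (D ∪ ⟦ suc s ⟧) t ≡ 0 → top D ≤ t
    zero⇒top≤ t eq = count≥≡0⇒top≤ D t (m+n≡0⇒m≡0 (count≥ D t) (trans (sym (counts t)) eq))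
    top≤⇒zero : ∀ t → top D ≤ t → count≥ (D ∪ ⟦ suc s ⟧) t ≡ 0
    top≤⇒zero t top≤t rewrite counts t | top≤⇒count≥≡0 D t top≤t | 𝟙<≡0 (≤-trans (<⇒≤ s<top) top≤t) = refl

  dropTop-∪⟦⟧-below : ∀ {n} (D : Subset n) s → suc s < top D → member D s ≡ false →
                      dropTop (D ∪ ⟦ suc s ⟧) ≡ dropTop D ∪ ⟦ suc s ⟧
  dropTop-∪⟦⟧-below D s s<top s∉D = count≥-injective _ _ counts
    where
    bound = ≤-trans (<⇒≤ s<top) (top≤n D)
    counts : ∀ t → count≥ (dropTop (D ∪ ⟦ suc s ⟧)) t ≡ count≥ (dropTop D ∪ ⟦ suc s ⟧) t
    counts t rewrite count≥-dropTop (D ∪ ⟦ suc s ⟧) t | count≥-∪⟦suc⟧ D s s∉D bound t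
                   | count≥-∪⟦suc⟧ (dropTop D) s (∉⇒∉dropTop D s s∉D) bound t | count≥-dropTop D t
      with t <? top D
    ... | yes t<top = +-∸-comm (𝟙< t (suc s)) (<top⇒count≥>0 D t t<top)
    ... | no  t≮top rewrite top≤⇒count≥≡0 D t (≮⇒≥ t≮top) | 𝟙<≡0 (≤-trans (<⇒≤ s<top) (≮⇒≥ t≮top)) = refl

  top-∖⟦⟧-below : ∀ {n} (Y : Subset n) s → suc s < top Y → member Y s ≡ true → top (Y ∩ ∁ ⟦ suc s ⟧) ≡ top Y
  top-∖⟦⟧-below Y s s<top s∈Y = top-unique (Y ∩ ∁ ⟦ suc s ⟧) (top Y) zero⇒top≤ top≤⇒zero
    where
    counts = count≥-∖⟦suc⟧ Y s s∈Y
    two≤ : ∀ t → t ≤ s → 2 ≤ count≥ Y t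
    two≤ t t≤s = begin
      2                      ≤⟨ s≤s (<top⇒count≥>0 Y (suc s) s<top) ⟩
      suc (count≥ Y (suc s)) ≡⟨ count≥-∈ Y s s∈Y ⟨
      count≥ Y s             ≤⟨ count≥-antitone Y t≤s ⟩
      count≥ Y t             ∎
      where open ≤-Reasoning
    zero⇒top≤ : ∀ t → count≥ (Y ∩ ∁ ⟦ suc s ⟧) t ≡ 0 → top Y ≤ t
    zero⇒top≤ t eq with t ≤? s | trans (sym (counts t)) eq
    ... | yes t≤s | eq′ rewrite 𝟙<≡1 (s≤s t≤s) = ⊥-elim (<⇒≱ (two≤ t t≤s) (m∸n≡0⇒m≤n eq′))
    ... | no  t≰s | eq′ rewrite 𝟙<≡0 (≰⇒> t≰s) = count≥≡0⇒top≤ Y t eq′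
    top≤⇒zero : ∀ t → top Y ≤ t → count≥ (Y ∩ ∁ ⟦ suc s ⟧) t ≡ 0
    top≤⇒zero t top≤t rewrite counts t | top≤⇒count≥≡0 Y t top≤t = 0∸n≡0 (𝟙< t (suc s))

  dropTop-∖⟦⟧-below : ∀ {n} (Y : Subset n) s → suc s < top Y → member Y s ≡ true →
                      dropTop (Y ∩ ∁ ⟦ suc s ⟧) ≡ dropTop Y ∩ ∁ ⟦ suc s ⟧
  dropTop-∖⟦⟧-below Y s s<top s∈Y = count≥-injective _ _ counts
    where
    counts : ∀ t → count≥ (dropTop (Y ∩ ∁ ⟦ suc s ⟧)) t ≡ count≥ (dropTop Y ∩ ∁ ⟦ suc s ⟧) t
    counts t rewrite count≥-dropTop (Y ∩ ∁ ⟦ suc s ⟧) t | count≥-∖⟦suc⟧ Y s s∈Y t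
                   | count≥-∖⟦suc⟧ (dropTop Y) s (∈⇒∈dropTop Y s s<top s∈Y) t | count≥-dropTop Y t =
      ∸-swap (count≥ Y t) (𝟙< t (suc s)) 1
      where
      ∸-swap : ∀ a b c → a ∸ b ∸ c ≡ a ∸ c ∸ b
      ∸-swap a b c = trans (∸-+-assoc a b c) (trans (cong (a ∸_) (+-comm b c)) (sym (∸-+-assoc a c b)))

  violation-dropTop : ∀ {n} (Y D : Subset n) → top Y ≤ top D → violation Y D ≡ violation (dropTop Y) (dropTop D)
  violation-dropTop Y D topY≤topD = violation-cong Y D (dropTop Y) (dropTop D) to from
    where
    below-top : ∀ t → count≥ D t < count≥ Y t → t < top D
    below-top t lt = ≰⇒> (λ top≤t → <⇒≱ lt (subst (_≤ count≥ D t)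
                             (sym (top≤⇒count≥≡0 Y t (≤-trans topY≤topD top≤t))) z≤n))
    to : ∀ t → count≥ D t < count≥ Y t → count≥ (dropTop D) t < count≥ (dropTop Y) t
    to t lt rewrite count≥-dropTop D t | count≥-dropTop Y t = ∸-monoˡ-< lt (<top⇒count≥>0 D t (below-top t lt))
    from : ∀ t → count≥ (dropTop D) t < count≥ (dropTop Y) t → count≥ D t < count≥ Y t
    from t lt rewrite count≥-dropTop D t | count≥-dropTop Y t = pred-cancel-< lt

  violation<top : ∀ {n} (Y D : Subset n) s → violation Y D ≡ suc s → top Y ≤ top D →
                  suc s < top D × suc s < top Y
  violation<top Y D s e topY≤topD = s+1<topD , s+1<topY
    where
    lt = proj₁ (violation≡suc Y D s e)
    s<topY : s < top Y
    s<topY = ≰⇒> (λ topY≤s → <⇒≱ lt (subst (_≤ count≥ D s) (sym (top≤⇒count≥≡0 Y s topY≤s)) z≤n))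
    s<topD : s < top D
    s<topD = ≤-trans s<topY topY≤topD
    s+1<topD : suc s < top D
    s+1<topD = ≤∧≢⇒< s<topD (λ eq → case trans (sym (top≡suc⇒∈ D s (sym eq))) (proj₂ (violation-∈∉ Y D s e)) of λ ())
    s+1<topY : suc s < top Y
    s+1<topY = ≰⇒> (λ topY≤s+1 → <⇒≱ (begin
      2                       ≤⟨ s≤s (<top⇒count≥>0 D s s<topD) ⟩
      suc (count≥ D s)        ≤⟨ lt ⟩
      count≥ Y s              ≡⟨ count≥-∈ Y s (proj₁ (violation-∈∉ Y D s e)) ⟩
      suc (count≥ Y (suc s))  ≡⟨ cong suc (top≤⇒count≥≡0 Y (suc s) topY≤s+1) ⟩
      1                       ∎) (s≤s z≤n))
      where open ≤-Reasoning

  violation≤⇒≤ : ∀ {n} (Y D : Subset n) t → violation Y D ≤ t → count≥ Y t ≤ count≥ D t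
  violation≤⇒≤ Y D t v≤t with violation Y D in e
  ... | zero  = violation≡0⇒≼ Y D e t
  ... | suc k = proj₂ (violation≡suc Y D k e) t v≤t

  ≤-from⇒violation≤ : ∀ {n} (Y D : Subset n) a → (∀ t → a ≤ t → count≥ Y t ≤ count≥ D t) → violation Y D ≤ a
  ≤-from⇒violation≤ Y D a above with violation Y D in e
  ... | zero  = z≤n
  ... | suc k = ≰⇒> (λ a≤k → <⇒≱ (proj₁ (violation≡suc Y D k e)) (above k a≤k))

  violation∈ : ∀ {n} (Y D : Subset n) k → violation Y D ≡ suc k → member Y k ≡ true
  violation∈ Y D k e = proj₁ (violation-∈∉ Y D k e)

  violation∉ : ∀ {n} (Y D : Subset n) k → violation Y D ≡ suc k → member D k ≡ false
  violation∉ Y D k e = proj₂ (violation-∈∉ Y D k e)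

  infix 4 _≼⁺_
  _≼⁺_ : ∀ {n} → Subset n → Subset n → Set
  Y ≼⁺ D = ∀ t → count≥ Y t ≤ suc (count≥ D t)

  ∪⟦⟧-≼⁺ : ∀ {n} (C D : Subset n) a → a ≤ n → (∀ k → a ≡ suc k → member C k ≡ false) → C ≼ D → C ∪ ⟦ a ⟧ ≼⁺ D
  ∪⟦⟧-≼⁺ C D a a≤n a∉C C≼D t rewrite count≥-∪⟦⟧ C a a≤n a∉C t =
    ≤-trans (+-mono-≤ (C≼D t) (𝟙<≤1 t a)) (≤-reflexive (+-comm (count≥ D t) 1))

  Strict : ∀ {n} → ℕ → Subset n → Subset n → Set
  Strict a C Y = ∀ t → t < a → count≥ C t < count≥ Y t

  ∖violation≼∪violation : ∀ {n} (Y D : Subset n) → Y ≼⁺ D → Y ∩ ∁ ⟦ violation Y D ⟧ ≼ D ∪ ⟦ violation Y D ⟧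
  ∖violation≼∪violation Y D Y≼⁺D t
    rewrite count≥-∪⟦⟧ D (violation Y D) (violation≤n Y D _ refl) (violation∉ Y D) t
          | count≥-∖⟦⟧ Y (violation Y D) (violation∈ Y D) t
    with t <? violation Y D
  ... | yes t<v rewrite 𝟙<≡1 t<v = ≤-trans (∸-monoˡ-≤ 1 (Y≼⁺D t)) (m≤m+n (count≥ D t) 1)
  ... | no  t≮v rewrite 𝟙<≡0 (≮⇒≥ t≮v) | +-identityʳ (count≥ D t) = violation≤⇒≤ Y D t (≮⇒≥ t≮v)

  strict-∖violation-∪violation : ∀ {n} (Y D : Subset n) → Y ≼⁺ D →
                                 Strict (violation Y D) (Y ∩ ∁ ⟦ violation Y D ⟧) (D ∪ ⟦ violation Y D ⟧)
  strict-∖violation-∪violation Y D Y≼⁺D t t<v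
    rewrite count≥-∪⟦⟧ D (violation Y D) (violation≤n Y D _ refl) (violation∉ Y D) t
          | count≥-∖⟦⟧ Y (violation Y D) (violation∈ Y D) t | 𝟙<≡1 t<v
          | +-comm (count≥ D t) 1 = s≤s (∸-monoˡ-≤ 1 (Y≼⁺D t))

  ≼-∖⟦⟧ : ∀ {n} (C Y : Subset n) s → (∀ k → s ≡ suc k → member Y k ≡ true) → C ≼ Y → Strict s C Y →
          C ≼ Y ∩ ∁ ⟦ s ⟧
  ≼-∖⟦⟧ C Y s s∈Y C≼Y strict t rewrite count≥-∖⟦⟧ Y s s∈Y t with t <? s
  ... | yes t<s rewrite 𝟙<≡1 t<s = <⇒≤pred (strict t t<s)
  ... | no  t≮s rewrite 𝟙<≡0 (≮⇒≥ t≮s) = C≼Y t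

module RowInsertion where

  -- Rows are weakly decreasing lists of letters padded with 0s. Inserting x bumps the first
  -- entry smaller than x (the bumped letter is 0 if there is none) and lengthens the row by one.
  rowInsert : List ℕ → ℕ → List ℕ × ℕ
  rowInsert []      x = x ∷ [] , 0
  rowInsert (r ∷ R) x with r <? x
  ... | yes _ = x ∷ (R ∷ʳ 0) , r
  ... | no  _ = r ∷ proj₁ (rowInsert R x) , proj₂ (rowInsert R x)

  row : List ℕ → ℕ → List ℕ
  row R x = proj₁ (rowInsert R x)

  bump : List ℕ → ℕ → ℕ
  bump R x = proj₂ (rowInsert R x)

  Decreasing : List ℕ → Set
  Decreasing = AllPairs _≥_

  row-All≤ : ∀ R x {m} → All (_≤ m) R → x ≤ m → All (_≤ m) (row R x)
  row-All≤ []      x _         x≤m = x≤m ∷ []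
  row-All≤ (r ∷ R) x (r≤m ∷ R≤m) x≤m with r <? x
  ... | yes _ = x≤m ∷ All.∷ʳ⁺ R≤m z≤n
  ... | no  _ = r≤m ∷ row-All≤ R x R≤m x≤m

  bump≤ : ∀ R x {m} → All (_≤ m) R → bump R x ≤ m
  bump≤ []      x _           = z≤n
  bump≤ (r ∷ R) x (r≤m ∷ R≤m) with r <? x
  ... | yes _ = r≤m
  ... | no  _ = bump≤ R x R≤m

  bump< : ∀ R x → 0 < x → bump R x < x
  bump< []      x 0<x = 0<x
  bump< (r ∷ R) x 0<x with r <? x
  ... | yes r<x = r<x
  ... | no  _   = bump< R x 0<x

  bump-0 : ∀ R → bump R 0 ≡ 0
  bump-0 []      = refl
  bump-0 (r ∷ R) with r <? 0
  ... | no _ = bump-0 R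

  rowInsert-∷ʳ0 : ∀ R x → rowInsert (R ∷ʳ 0) x ≡ (row R x ∷ʳ 0 , bump R x)
  rowInsert-∷ʳ0 [] x with 0 <? x
  rowInsert-∷ʳ0 [] x       | yes _ = refl
  rowInsert-∷ʳ0 [] zero    | no  _ = refl
  rowInsert-∷ʳ0 [] (suc x) | no 0≮x = ⊥-elim (0≮x z<s)
  rowInsert-∷ʳ0 (r ∷ R) x with r <? x
  ... | yes _ = refl
  ... | no  _ rewrite rowInsert-∷ʳ0 R x = refl

  row-∷ʳ0 : ∀ R x → row (R ∷ʳ 0) x ≡ row R x ∷ʳ 0
  row-∷ʳ0 R x = cong proj₁ (rowInsert-∷ʳ0 R x)

  bump-∷ʳ0 : ∀ R x → bump (R ∷ʳ 0) x ≡ bump R x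
  bump-∷ʳ0 R x = cong proj₂ (rowInsert-∷ʳ0 R x)

  a≤bump-after-a : ∀ R a b → a < b → a ≤ bump (row R a) b
  a≤bump-after-a [] a b a<b with a <? b
  ... | yes _   = ≤-refl
  ... | no  a≮b = ⊥-elim (a≮b a<b)
  a≤bump-after-a (r ∷ R) a b a<b with r <? a
  ... | yes _ with a <? b
  ...   | yes _   = ≤-refl
  ...   | no  a≮b = ⊥-elim (a≮b a<b)
  a≤bump-after-a (r ∷ R) a b a<b | no r≮a with r <? b
  ...   | yes _ = ≮⇒≥ r≮a
  ...   | no  _ = a≤bump-after-a R a b a<b

  bump-after-b≤bump : ∀ R a b → Decreasing R → a ≤ b → bump (row R b) a ≤ bump R b
  bump-after-b≤bump [] a b _ a≤b with b <? a
  ... | yes b<a = ⊥-elim (<⇒≱ b<a a≤b)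
  ... | no  _   = ≤-refl
  bump-after-b≤bump (r ∷ R) a b (R≤r ∷ R↓) a≤b with r <? b
  ... | yes _ with b <? a
  ...   | yes b<a = ⊥-elim (<⇒≱ b<a a≤b)
  ...   | no  _   = bump≤ (R ∷ʳ 0) a (All.∷ʳ⁺ R≤r z≤n)
  bump-after-b≤bump (r ∷ R) a b (R≤r ∷ R↓) a≤b | no r≮b with r <? a
  ...   | yes r<a = ⊥-elim (r≮b (≤-trans r<a a≤b))
  ...   | no  _   = bump-after-b≤bump R a b R↓ a≤b

  row≢[] : ∀ R x → row R x ≢ []
  row≢[] []      x ()
  row≢[] (r ∷ R) x with r <? x
  ... | yes _ = λ ()
  ... | no  _ = λ ()

  Triple : Set
  Triple = ℕ × ℕ × ℕ

  insert3 : List ℕ → Triple → List ℕ × Triple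
  insert3 R (x , y , z) = row (row (row R x) y) z , bump R x , bump (row R x) y , bump (row (row R x) y) z

  -- Bumped triples may contain the non-letter 0, which lies strictly below every letter.
  _<₀_ : ℕ → ℕ → Set
  a <₀ b = a < b ⊎ a ≡ 0

  <₀-≤⇒≤ : ∀ {a b c} → a <₀ b → b ≤ c → a ≤ c
  <₀-≤⇒≤ (inj₁ a<b)  b≤c = ≤-trans (<⇒≤ a<b) b≤c
  <₀-≤⇒≤ (inj₂ refl) _   = z≤n

  -- The relations of KnuthStep read backwards, since the letters of w are inserted from the left.
  data KnuthStep3 : Triple → Triple → Set where
    cab-acb : ∀ {a b c} → a <₀ b → b ≤ c → KnuthStep3 (c , a , b) (a , c , b)
    bca-bac : ∀ {a b c} → a ≤ b → b < c → KnuthStep3 (b , c , a) (b , a , c)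

  Knuth3 : Triple → Triple → Set
  Knuth3 = SymClosure KnuthStep3

  Compatible : List ℕ → Triple → Triple → Set
  Compatible R p q = proj₁ (insert3 R p) ≡ proj₁ (insert3 R q) ×
                     (proj₂ (insert3 R p) ≡ proj₂ (insert3 R q) ⊎ Knuth3 (proj₂ (insert3 R p)) (proj₂ (insert3 R q)))

  compatible-sym : ∀ R p q → Compatible R p q → Compatible R q p
  compatible-sym R p q (same-row , inj₁ same-bumps) = sym same-row , inj₁ (sym same-bumps)
  compatible-sym R p q (same-row , inj₂ knuth)      = sym same-row , inj₂ (SymClosure.symmetric KnuthStep3 knuth)

  insert3-∷-above : ∀ r S x y z → x ≤ r → y ≤ r → z ≤ r →
                    insert3 (r ∷ S) (x , y , z) ≡ (r ∷ proj₁ (insert3 S (x , y , z)) , proj₂ (insert3 S (x , y , z)))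
  insert3-∷-above r S x y z x≤r y≤r z≤r with r <? x
  ... | yes r<x = ⊥-elim (<⇒≱ r<x x≤r)
  ... | no  _ with r <? y
  ...   | yes r<y = ⊥-elim (<⇒≱ r<y y≤r)
  ...   | no  _ with r <? z
  ...     | yes r<z = ⊥-elim (<⇒≱ r<z z≤r)
  ...     | no  _   = refl

  Triple≤ : Triple → ℕ → Set
  Triple≤ (x , y , z) r = x ≤ r × y ≤ r × z ≤ r

  compatible-∷-above : ∀ r S p q → Triple≤ p r → Triple≤ q r → Compatible S p q → Compatible (r ∷ S) p q
  compatible-∷-above r S p@(x , y , z) q@(x′ , y′ , z′) (x≤r , y≤r , z≤r) (x′≤r , y′≤r , z′≤r) (same-row , bumps) =
    subst₂ (λ P Q → proj₁ P ≡ proj₁ Q × (proj₂ P ≡ proj₂ Q ⊎ Knuth3 (proj₂ P) (proj₂ Q)))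
      (sym (insert3-∷-above r S x y z x≤r y≤r z≤r)) (sym (insert3-∷-above r S x′ y′ z′ x′≤r y′≤r z′≤r))
      (cong (r ∷_) same-row , bumps)

  insert3-∷ʳ0 : ∀ S t → insert3 (S ∷ʳ 0) t ≡ (proj₁ (insert3 S t) ∷ʳ 0 , proj₂ (insert3 S t))
  insert3-∷ʳ0 S (x , y , z)
    rewrite rowInsert-∷ʳ0 S x | rowInsert-∷ʳ0 (row S x) y | rowInsert-∷ʳ0 (row (row S x) y) z = refl

  compatible-[0]⇒[] : ∀ p q → Compatible (0 ∷ []) p q → Compatible [] p q
  compatible-[0]⇒[] p q (same-row , bumps) =
    ∷ʳ-injectiveˡ _ _ (trans (sym (cong proj₁ (insert3-∷ʳ0 [] p))) (trans same-row (cong proj₁ (insert3-∷ʳ0 [] q)))) ,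
    subst₂ (λ u v → u ≡ v ⊎ Knuth3 u v) (cong proj₂ (insert3-∷ʳ0 [] p)) (cong proj₂ (insert3-∷ʳ0 [] q)) bumps

  mk-cab-acb : ∀ {c a b x y z} → x ≡ a → y ≡ c → z ≡ b → a <₀ b → b ≤ c → KnuthStep3 (c , a , b) (x , y , z)
  mk-cab-acb refl refl refl = cab-acb

  mk-bca-bac : ∀ {a b c x z} → x ≡ a → z ≡ c → a ≤ b → b < c → KnuthStep3 (b , c , x) (b , a , z)
  mk-bca-bac refl refl = bca-bac

  bump<₀bump : ∀ R a b → a <₀ b → bump R a <₀ bump (row R a) b
  bump<₀bump R a       b (inj₂ refl) = inj₂ (bump-0 R)
  bump<₀bump R zero    b (inj₁ _)    = inj₂ (bump-0 R)
  bump<₀bump R (suc a) b (inj₁ a<b)  = inj₁ (<-≤-trans (bump< R (suc a) z<s) (a≤bump-after-a R (suc a) b a<b))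

  insert-twice-below : ∀ r R a b → All (_≤ r) R → r < a → a < b →
                       row (row (R ∷ʳ 0) a) b ≡ row ((R ∷ʳ 0) ∷ʳ 0) b ×
                       bump (row (R ∷ʳ 0) a) b ≡ a ×
                       bump ((R ∷ʳ 0) ∷ʳ 0) b ≡ bump (R ∷ʳ 0) a
  insert-twice-below r [] a b _ r<a a<b with 0 <? a | 0 <? b
  ... | no 0≮a | _      = ⊥-elim (0≮a (≤-<-trans z≤n r<a))
  ... | yes _  | no 0≮b = ⊥-elim (0≮b (≤-<-trans z≤n (<-trans r<a a<b)))
  ... | yes _  | yes _ with a <? b
  ...   | no a≮b = ⊥-elim (a≮b a<b)
  ...   | yes _  = refl , refl , refl
  insert-twice-below r (h ∷ R) a b (h≤r ∷ _) r<a a<b with h <? a | h <? b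
  ... | no h≮a | _      = ⊥-elim (h≮a (≤-<-trans h≤r r<a))
  ... | yes _  | no h≮b = ⊥-elim (h≮b (≤-<-trans h≤r (<-trans r<a a<b)))
  ... | yes _  | yes _ with a <? b
  ...   | no a≮b = ⊥-elim (a≮b a<b)
  ...   | yes _  = refl , refl , refl

  compatible-cab-head<a : ∀ r R a b c → All (_≤ r) R → r < c → r < a → a < b → b ≤ c →
                          Compatible (r ∷ R) (c , a , b) (a , c , b)
  compatible-cab-head<a r R a b c R≤r r<c r<a a<b b≤c with r <? c | r <? a
  ... | no r≮c | _      = ⊥-elim (r≮c r<c)
  ... | yes _  | no r≮a = ⊥-elim (r≮a r<a)
  ... | yes _  | yes _ with c <? a | a <? c
  ...   | yes c<a | _      = ⊥-elim (<⇒≱ c<a (≤-trans (<⇒≤ a<b) b≤c))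
  ...   | no _    | no a≮c = ⊥-elim (a≮c (≤-trans a<b b≤c))
  ...   | no _    | yes _ with c <? b
  ...     | yes c<b = ⊥-elim (<⇒≱ c<b b≤c)
  ...     | no _ with insert-twice-below r R a b R≤r r<a a<b
  ...       | same-row , bumps-a , same-bump =
    cong (c ∷_) same-row , inj₂ (bwd (mk-bca-bac same-bump bumps-a (bump≤ (R ∷ʳ 0) a (All.∷ʳ⁺ R≤r z≤n)) r<a))

  compatible-cab-a≤head : ∀ r R a b c → All (_≤ r) R → r < c → a ≤ r → a <₀ b → b ≤ c →
                          Compatible (r ∷ R) (c , a , b) (a , c , b)
  compatible-cab-a≤head r R a b c R≤r r<c a≤r a<₀b b≤c with r <? c | r <? a
  ... | no r≮c | _      = ⊥-elim (r≮c r<c)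
  ... | yes _  | yes r<a = ⊥-elim (<⇒≱ r<a a≤r)
  ... | yes _  | no _ with c <? a | r <? c
  ...   | yes c<a | _      = ⊥-elim (<⇒≱ c<a (<₀-≤⇒≤ a<₀b b≤c))
  ...   | no _    | no r≮c = ⊥-elim (r≮c r<c)
  ...   | no _    | yes _ with c <? b
  ...     | yes c<b = ⊥-elim (<⇒≱ c<b b≤c)
  ...     | no _ =
    cong (λ P → c ∷ row (proj₁ P) b) (rowInsert-∷ʳ0 R a) ,
    inj₂ (fwd (mk-cab-acb (sym (bump-∷ʳ0 R a)) refl (sym (cong (λ P → bump (proj₁ P) b) (rowInsert-∷ʳ0 R a)))
                          (bump<₀bump (R ∷ʳ 0) a b a<₀b) (bump≤ (row (R ∷ʳ 0) a) b (row-All≤ (R ∷ʳ 0) a (All.∷ʳ⁺ R≤r z≤n) a≤r))))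

  compatible-bca-head<b : ∀ r R a b c → All (_≤ r) R → r < c → r < b → a ≤ b → b < c →
                          Compatible (r ∷ R) (b , c , a) (b , a , c)
  compatible-bca-head<b r R a b c R≤r r<c r<b a≤b b<c with r <? b
  ... | no r≮b = ⊥-elim (r≮b r<b)
  ... | yes _ with b <? c | b <? a
  ...   | no b≮c | _      = ⊥-elim (b≮c b<c)
  ...   | yes _  | yes b<a = ⊥-elim (<⇒≱ b<a a≤b)
  ...   | yes _  | no _ with c <? a | b <? c
  ...     | yes c<a | _      = ⊥-elim (<⇒≱ c<a (≤-trans a≤b (<⇒≤ b<c)))
  ...     | no _    | no b≮c = ⊥-elim (b≮c b<c)
  ...     | no _    | yes _  =
    cong (c ∷_) (row-∷ʳ0 (R ∷ʳ 0) a) ,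
    inj₂ (fwd (mk-bca-bac (bump-∷ʳ0 (R ∷ʳ 0) a) refl (bump≤ (R ∷ʳ 0) a (All.∷ʳ⁺ R≤r z≤n)) r<b))

  compatible-bca-b≤head : ∀ r R a b c → All (_≤ r) R → Decreasing R → r < c → b ≤ r → a ≤ b →
                          Compatible (r ∷ R) (b , c , a) (b , a , c)
  compatible-bca-b≤head r R a b c R≤r R↓ r<c b≤r a≤b with r <? b
  ... | yes r<b = ⊥-elim (<⇒≱ r<b b≤r)
  ... | no _ with r <? c | r <? a
  ...   | no r≮c | _      = ⊥-elim (r≮c r<c)
  ...   | yes _  | yes r<a = ⊥-elim (<⇒≱ r<a (≤-trans a≤b b≤r))
  ...   | yes _  | no _ with c <? a | r <? c
  ...     | yes c<a | _      = ⊥-elim (<⇒≱ c<a (≤-trans (≤-trans a≤b b≤r) (<⇒≤ r<c)))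
  ...     | no _    | no r≮c = ⊥-elim (r≮c r<c)
  ...     | no _    | yes _  = cong (c ∷_) (row-∷ʳ0 (row R b) a) , bumps r refl
    where
    bb = bump R b
    ba = bump (row R b) a
    ba≤bb : ba ≤ bb
    ba≤bb = bump-after-b≤bump R a b R↓ a≤b
    bb<r : ∀ {b′} → b′ ≡ b → 0 < r → bb < r
    bb<r {zero}  refl 0<r = subst (_< r) (sym (bump-0 R)) 0<r
    bb<r {suc _} refl _   = <-≤-trans (bump< R b z<s) b≤r
    bumps : ∀ r′ → r′ ≡ r → (bb , r , bump (row R b ∷ʳ 0) a) ≡ (bb , ba , r) ⊎
                            Knuth3 (bb , r , bump (row R b ∷ʳ 0) a) (bb , ba , r)
    bumps (suc _) refl = inj₂ (fwd (mk-bca-bac (bump-∷ʳ0 (row R b) a) refl ba≤bb (bb<r refl z<s)))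
    bumps zero    refl = inj₁ (cong₂ (λ u v → (bb , u , v)) (sym ba≡0) (trans (bump-∷ʳ0 (row R b) a) ba≡0))
      where
      ba≡0 : ba ≡ 0
      ba≡0 = n≤0⇒n≡0 (≤-trans ba≤bb (≤-reflexive (subst (λ w → bump R w ≡ 0) (sym (n≤0⇒n≡0 b≤r)) (bump-0 R))))

  compatible-cab-∷ : ∀ r R a b c → All (_≤ r) R → a <₀ b → b ≤ c →
                     (c ≤ r → Compatible R (c , a , b) (a , c , b)) → Compatible (r ∷ R) (c , a , b) (a , c , b)
  compatible-cab-∷ r R a b c R≤r a<₀b b≤c tail with ≤-<-connex c r
  ... | inj₁ c≤r = compatible-∷-above r R (c , a , b) (a , c , b) (c≤r , a≤r , b≤r) (a≤r , c≤r , b≤r) (tail c≤r)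
    where
    b≤r = ≤-trans b≤c c≤r
    a≤r = <₀-≤⇒≤ a<₀b b≤r
  ... | inj₂ r<c with <-≤-connex r a | a<₀b
  ...   | inj₁ r<a | inj₁ a<b  = compatible-cab-head<a r R a b c R≤r r<c r<a a<b b≤c
  ...   | inj₁ r<a | inj₂ refl = ⊥-elim (n≮0 r<a)
  ...   | inj₂ a≤r | _         = compatible-cab-a≤head r R a b c R≤r r<c a≤r a<₀b b≤c

  compatible-cab : ∀ R a b c → Decreasing R → a <₀ b → b ≤ c → Compatible R (c , a , b) (a , c , b)
  compatible-cab [] a b c _ a<₀b b≤c =
    compatible-[0]⇒[] (c , a , b) (a , c , b) (compatible-cab-∷ 0 [] a b c [] a<₀b b≤c all-zero)
    where
    all-zero : c ≤ 0 → Compatible [] (c , a , b) (a , c , b)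
    all-zero c≤0 with n≤0⇒n≡0 c≤0 | n≤0⇒n≡0 (≤-trans b≤c c≤0) | n≤0⇒n≡0 (<₀-≤⇒≤ a<₀b (≤-trans b≤c c≤0))
    ... | refl | refl | refl = refl , inj₁ refl
  compatible-cab (r ∷ R) a b c (R≤r ∷ R↓) a<₀b b≤c =
    compatible-cab-∷ r R a b c R≤r a<₀b b≤c (λ _ → compatible-cab R a b c R↓ a<₀b b≤c)

  compatible-bca-∷ : ∀ r R a b c → All (_≤ r) R → Decreasing R → a ≤ b → b < c →
                     (c ≤ r → Compatible R (b , c , a) (b , a , c)) → Compatible (r ∷ R) (b , c , a) (b , a , c)
  compatible-bca-∷ r R a b c R≤r R↓ a≤b b<c tail with ≤-<-connex c r
  ... | inj₁ c≤r = compatible-∷-above r R (b , c , a) (b , a , c) (b≤r , c≤r , a≤r) (b≤r , a≤r , c≤r) (tail c≤r)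
    where
    b≤r = ≤-trans (<⇒≤ b<c) c≤r
    a≤r = ≤-trans a≤b b≤r
  ... | inj₂ r<c with <-≤-connex r b
  ...   | inj₁ r<b = compatible-bca-head<b r R a b c R≤r r<c r<b a≤b b<c
  ...   | inj₂ b≤r = compatible-bca-b≤head r R a b c R≤r R↓ r<c b≤r a≤b

  compatible-bca : ∀ R a b c → Decreasing R → a ≤ b → b < c → Compatible R (b , c , a) (b , a , c)
  compatible-bca [] a b c _ a≤b b<c =
    compatible-[0]⇒[] (b , c , a) (b , a , c) (compatible-bca-∷ 0 [] a b c [] [] a≤b b<c (λ c≤0 → ⊥-elim (<⇒≱ (≤-<-trans z≤n b<c) c≤0)))
  compatible-bca (r ∷ R) a b c (R≤r ∷ R↓) a≤b b<c =
    compatible-bca-∷ r R a b c R≤r R↓ a≤b b<c (λ _ → compatible-bca R a b c R↓ a≤b b<c)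

  compatible-knuthStep : ∀ R {p q} → Decreasing R → KnuthStep3 p q → Compatible R p q
  compatible-knuthStep R R↓ (cab-acb a<₀b b≤c) = compatible-cab R _ _ _ R↓ a<₀b b≤c
  compatible-knuthStep R R↓ (bca-bac a≤b b<c)  = compatible-bca R _ _ _ R↓ a≤b b<c

  compatible-knuth : ∀ R {p q} → Decreasing R → Knuth3 p q → Compatible R p q
  compatible-knuth R R↓ (fwd step) = compatible-knuthStep R R↓ step
  compatible-knuth R R↓ (bwd step) = compatible-sym R _ _ (compatible-knuthStep R R↓ step)

  insertTableau : List (List ℕ) → ℕ → List (List ℕ)
  insertTableau []      x = []
  insertTableau (R ∷ P) x = row R x ∷ insertTableau P (bump R x)

  insertTableau3 : List (List ℕ) → Triple → List (List ℕ)
  insertTableau3 P (x , y , z) = insertTableau (insertTableau (insertTableau P x) y) z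

  insertTableau3-knuth : ∀ P {p q} → All Decreasing P → Knuth3 p q → insertTableau3 P p ≡ insertTableau3 P q
  insertTableau3-knuth []      _          _     = refl
  insertTableau3-knuth (R ∷ P) (R↓ ∷ P↓) knuth with compatible-knuth R R↓ knuth
  ... | same-row , inj₁ same-bumps = cong₂ _∷_ same-row (cong (insertTableau3 P) same-bumps)
  ... | same-row , inj₂ knuth′     = cong₂ _∷_ same-row (insertTableau3-knuth P P↓ knuth′)

module Sweep where

  open SuffixCounts
  open RowInsertion

  infix 4 _≽_
  _≽_ : ∀ {n} → Subset n → Subset n → Set
  D ≽ C = C ≼ D

  HighestWeight : ∀ {n} → List (Subset n) → Set
  HighestWeight = Linked _≽_

  head⊥ : ∀ {n} → List (Subset n) → Subset n
  head⊥ []      = ⊥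
  head⊥ (C ∷ _) = C

  head⊥-≼ : ∀ {n} {D : Subset n} {T} → HighestWeight (D ∷ T) → head⊥ T ≼ D
  head⊥-≼ {n} {D} [-]     t = subst (_≤ count≥ D t) (sym (count≥-⊥ {n} t)) z≤n
  head⊥-≼         (C≼D ∷ _) = C≼D

  -- On the configurations that occur this is e⋆₁ (eInterval≡sweep).
  moveDown : ∀ {n} → Subset n → List (Subset n) → List (Subset n)
  moveDown D []      = D ∷ []
  moveDown D (Y ∷ R) = (D ∪ ⟦ violation Y D ⟧) ∷ (Y ∩ ∁ ⟦ violation Y D ⟧) ∷ R

  sweep : ∀ {n} → List (Subset n) → Subset n → List (Subset n)
  sweep []      X = X ∷ []
  sweep (D ∷ T) X = moveDown D (sweep T X)

  tops : ∀ {n} → List (Subset n) → List ℕ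
  tops = map top

  dropTops : ∀ {n} → List (Subset n) → List (Subset n)
  dropTops = map dropTop

  moveDown-≼ : ∀ {n} (D Y : Subset n) R → Y ≼ D → moveDown D (Y ∷ R) ≡ D ∷ Y ∷ R
  moveDown-≼ D Y R Y≼D rewrite ≼⇒violation≡0 Y D Y≼D | ∪-identityʳ D | A∩∁⊥≡A Y = refl

  sweep-⊥ : ∀ {n} (T : List (Subset n)) → HighestWeight T → sweep T ⊥ ≡ T ∷ʳ ⊥
  sweep-⊥ []          _           = refl
  sweep-⊥ (D ∷ [])    _           = moveDown-≼ D ⊥ [] (head⊥-≼ {D = D} {[]} [-])
  sweep-⊥ (D ∷ C ∷ T) (C≼D ∷ hw) rewrite sweep-⊥ (C ∷ T) hw = moveDown-≼ D C (T ∷ʳ ⊥) C≼D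

  moveDown-top : ∀ {n} (D Y : Subset n) R k → top Y ≡ suc k → top D ≤ k →
                 moveDown D (Y ∷ R) ≡ (D ∪ ⟦ suc k ⟧) ∷ dropTop Y ∷ R
  moveDown-top D Y R k topY topD≤k rewrite violation-top Y D k topY topD≤k =
    cong (λ Z → (D ∪ ⟦ suc k ⟧) ∷ Z ∷ R) (subst (λ w → Y ∩ ∁ ⟦ w ⟧ ≡ dropTop Y) topY (A∖top≡dropTop Y))

  sweep-above : ∀ {n} C (T : List (Subset n)) k → All (λ C′ → top C′ ≤ k) (C ∷ T) → suc k ≤ n →
                sweep (C ∷ T) ⟦ suc k ⟧ ≡ (C ∪ ⟦ suc k ⟧) ∷ (T ∷ʳ ⊥)
  sweep-above {n} C [] k (C≤k ∷ []) k<n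
    rewrite violation-top ⟦ suc k ⟧ C k (top-⟦⟧ (suc k) k<n) C≤k | ∩-inverseʳ (⟦_⟧ {n} (suc k)) = refl
  sweep-above C (C₂ ∷ T) k (C≤k ∷ C₂≤k ∷ T≤k) k<n
    rewrite sweep-above C₂ T k (C₂≤k ∷ T≤k) k<n
          | violation-top (C₂ ∪ ⟦ suc k ⟧) C k (top-∪⟦⟧ C₂ (suc k) (s≤s C₂≤k) k<n) C≤k
          | ∪⟦⟧∖⟦⟧ C₂ (suc k) (s≤s C₂≤k) k<n = refl

  ≼-dropTop : ∀ {n} (C D : Subset n) → C ≼ D → dropTop C ≼ dropTop D
  ≼-dropTop C D C≼D t rewrite count≥-dropTop C t | count≥-dropTop D t = ∸-monoˡ-≤ 1 (C≼D t)

  highestWeight-dropTops : ∀ {n} {T : List (Subset n)} → HighestWeight T → HighestWeight (dropTops T)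
  highestWeight-dropTops hw = Linked.map⁺ (Linked.map (λ {D} {C} → ≼-dropTop C D) hw)

  tops-decreasing : ∀ {n} {T : List (Subset n)} → HighestWeight T → Decreasing (tops T)
  tops-decreasing hw = Linked.Linked⇒AllPairs (flip ≤-trans) (Linked.map⁺ (Linked.map (λ {D} {C} → ≼⇒top≤ C D) hw))

  tops≤top : ∀ {n} {D : Subset n} {T} → HighestWeight (D ∷ T) → All (_≤ top D) (tops T)
  tops≤top hw with tops-decreasing hw
  ... | tops≤ ∷ _ = tops≤

  top-dropTop≤ : ∀ {n} (C : Subset n) {k} → top C ≤ suc k → top (dropTop C) ≤ k
  top-dropTop≤ C topC≤ = ≤-trans (top-dropTop C) (∸-monoˡ-≤ 1 topC≤)

  dropTops≤ : ∀ {n} {D : Subset n} {T} k → HighestWeight (D ∷ T) → top D ≡ suc k →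
              All (λ C → top C ≤ k) (dropTops (D ∷ T))
  dropTops≤ {D = D} {T} k hw e = All.map⁺ (All.map (λ {C} → top-dropTop≤ C) tops≤)
    where
    tops≤ : All (λ C → top C ≤ suc k) (D ∷ T)
    tops≤ = ≤-reflexive e ∷ All.map⁻ (subst (λ w → All (_≤ w) (tops T)) e (tops≤top hw))

  sweep-dropTops-top : ∀ {n} (D : Subset n) T → HighestWeight (D ∷ T) →
                       sweep (dropTop D ∷ dropTops T) ⟦ top D ⟧ ≡ D ∷ (dropTops T ∷ʳ ⊥)
  sweep-dropTops-top D T hw with top D in e
  ... | zero rewrite sweep-⊥ (dropTop D ∷ dropTops T) (highestWeight-dropTops hw) | top≡0⇒dropTop≡id D e = refl
  ... | suc k rewrite sweep-above (dropTop D) (dropTops T) k (dropTops≤ k hw e) (subst (_≤ _) e (top≤n D)) =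
    cong (_∷ (dropTops T ∷ʳ ⊥)) (subst (λ w → dropTop D ∪ ⟦ w ⟧ ≡ D) e (dropTop-∪-top D))

  moveDown-below : ∀ {n} (D Y : Subset n) R → top Y ≤ top D →
                   tops (moveDown D (Y ∷ R)) ≡ top D ∷ top Y ∷ tops R ×
                   dropTops (moveDown D (Y ∷ R)) ≡ moveDown (dropTop D) (dropTop Y ∷ dropTops R)
  moveDown-below D Y R topY≤topD with violation Y D in e | violation-dropTop Y D topY≤topD
  ... | zero  | e′ rewrite ∪-identityʳ D | A∩∁⊥≡A Y
                         | moveDown-≼ (dropTop D) (dropTop Y) (dropTops R) (violation≡0⇒≼ (dropTop Y) (dropTop D) (sym e′)) = refl , refl
  ... | suc s | e′ rewrite sym e′ with violation<top Y D s e topY≤topD | violation-∈∉ Y D s e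
  ...   | s<topD , s<topY | s∈Y , s∉D
    rewrite top-∪⟦⟧-below D s s<topD s∉D | top-∖⟦⟧-below Y s s<topY s∈Y
          | dropTop-∪⟦⟧-below D s s<topD s∉D | dropTop-∖⟦⟧-below Y s s<topY s∈Y = refl , refl

  moveDown-above : ∀ {n} (D Y : Subset n) R k → top Y ≡ suc k → top D < suc k → suc k ≤ n →
                   tops (moveDown D (Y ∷ R)) ≡ suc k ∷ top (dropTop Y) ∷ tops R ×
                   dropTops (moveDown D (Y ∷ R)) ≡ D ∷ dropTop (dropTop Y) ∷ dropTops R
  moveDown-above D Y R k topY topD<x x≤n =
    trans (cong tops moved) (cong (_∷ _) (top-∪⟦⟧ D (suc k) topD<x x≤n)) ,
    trans (cong dropTops moved) (cong (_∷ _) (dropTop-∪⟦⟧ D (suc k) topD<x x≤n))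
    where
    moved = moveDown-top D Y R k topY (≤-pred topD<x)

  moveDown-rowInsert-above : ∀ {n} (D : Subset n) T x Y → HighestWeight (D ∷ T) → x ≤ n → top D < x →
    tops Y ≡ row (tops T) x → dropTops Y ≡ sweep (dropTops T) ⟦ bump (tops T) x ⟧ →
    tops (moveDown D Y) ≡ x ∷ (tops T ∷ʳ 0) × dropTops (moveDown D Y) ≡ D ∷ (dropTops T ∷ʳ ⊥)
  moveDown-rowInsert-above {n} D [] (suc k) (Y ∷ []) hw x≤n topD<x tops-eq drops-eq
    with moveDown-above D Y [] k (∷-injectiveˡ tops-eq) topD<x x≤n
  ... | tops-moved , drops-moved rewrite ∷-injectiveˡ drops-eq =
    trans tops-moved (cong (λ t → suc k ∷ t ∷ []) (top-⟦⟧ {n} 0 z≤n)) ,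
    trans drops-moved (cong (λ A → D ∷ A ∷ []) (dropTop-⟦⟧ {n} 0 z≤n))
  moveDown-rowInsert-above D (C ∷ T) x Y hw x≤n topD<x tops-eq drops-eq with top C <? x
  ... | no topC≮x = ⊥-elim (topC≮x (≤-<-trans (≼⇒top≤ C D (Linked.head hw)) topD<x))
  moveDown-rowInsert-above D (C ∷ T) (suc k) (Y ∷ R) hw x≤n topD<x tops-eq drops-eq | yes _
    with ∷-injective tops-eq | ∷-injective (trans drops-eq (sweep-dropTops-top C T (Linked.tail hw)))
  ... | topY , topsR | dropTopY , dropTopsR with moveDown-above D Y R k topY topD<x x≤n
  ... | tops-moved , drops-moved =
    trans tops-moved (cong₂ (λ A t → suc k ∷ top A ∷ t) dropTopY topsR) ,
    trans drops-moved (cong₂ (λ A As → D ∷ dropTop A ∷ As) dropTopY dropTopsR)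

  moveDown-rowInsert-below : ∀ {n} (D : Subset n) T x Y → HighestWeight (D ∷ T) → x ≤ top D →
    tops Y ≡ row (tops T) x → dropTops Y ≡ sweep (dropTops T) ⟦ bump (tops T) x ⟧ →
    tops (moveDown D Y) ≡ top D ∷ row (tops T) x ×
    dropTops (moveDown D Y) ≡ moveDown (dropTop D) (sweep (dropTops T) ⟦ bump (tops T) x ⟧)
  moveDown-rowInsert-below D T x []      hw x≤topD tops-eq drops-eq = ⊥-elim (row≢[] (tops T) x (sym tops-eq))
  moveDown-rowInsert-below D T x (Y ∷ R) hw x≤topD tops-eq drops-eq
    with subst (All (_≤ top D)) (sym tops-eq) (row-All≤ (tops T) x (tops≤top hw) x≤topD)
  ... | topY≤topD ∷ _ =
    trans (proj₁ (moveDown-below D Y R topY≤topD)) (cong (top D ∷_) tops-eq) ,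
    trans (proj₂ (moveDown-below D Y R topY≤topD)) (cong (moveDown (dropTop D)) drops-eq)

  sweep-rowInsert : ∀ {n} (T : List (Subset n)) x → HighestWeight T → x ≤ n →
    tops (sweep T ⟦ x ⟧) ≡ row (tops T) x × dropTops (sweep T ⟦ x ⟧) ≡ sweep (dropTops T) ⟦ bump (tops T) x ⟧
  sweep-rowInsert []      x _  x≤n = cong (_∷ []) (top-⟦⟧ x x≤n) , cong (_∷ []) (dropTop-⟦⟧ x x≤n)
  sweep-rowInsert (D ∷ T) x hw x≤n with top D <? x | sweep-rowInsert T x (Linked.tail hw) x≤n
  ... | yes topD<x | tops-eq , drops-eq
    with moveDown-rowInsert-above D T x (sweep T ⟦ x ⟧) hw x≤n topD<x tops-eq drops-eq
  ...   | tops-moved , drops-moved = tops-moved , trans drops-moved (sym (sweep-dropTops-top D T hw))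
  sweep-rowInsert (D ∷ T) x hw x≤n | no topD≮x | tops-eq , drops-eq =
    moveDown-rowInsert-below D T x (sweep T ⟦ x ⟧) hw (≮⇒≥ topD≮x) tops-eq drops-eq

  ∉⊥ : ∀ {n} k → member (⊥ {n}) k ≡ false
  ∉⊥ {zero}  k       = refl
  ∉⊥ {suc n} zero    = refl
  ∉⊥ {suc n} (suc k) = ∉⊥ {n} k

  highestWeight-∖⟦⟧ : ∀ {n} (Y : Subset n) R s a → (∀ k → s ≡ suc k → member Y k ≡ true) → s ≤ a →
                      Strict a (head⊥ R) Y → HighestWeight (Y ∷ R) → HighestWeight ((Y ∩ ∁ ⟦ s ⟧) ∷ R)
  highestWeight-∖⟦⟧ Y []      s a _   _   _      [-]        = [-]
  highestWeight-∖⟦⟧ Y (C ∷ R) s a s∈Y s≤a strict (C≼Y ∷ hw) =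
    ≼-∖⟦⟧ C Y s s∈Y C≼Y (λ t t<s → strict t (<-≤-trans t<s s≤a)) ∷ hw

  record SweepShape {n} (T Y : List (Subset n)) : Set where
    field
      bottom        : Subset n
      rest          : List (Subset n)
      letter        : ℕ
      shape         : Y ≡ bottom ∷ rest
      highestWeight : HighestWeight (bottom ∷ rest)
      bottom≡       : bottom ≡ head⊥ T ∪ ⟦ letter ⟧
      letter∉       : ∀ k → letter ≡ suc k → member (head⊥ T) k ≡ false
      letter≤n      : letter ≤ n
      strict        : Strict letter (head⊥ rest) bottom

  bottom≼⁺ : ∀ {n} {D : Subset n} {T Y} → HighestWeight (D ∷ T) → (S : SweepShape T Y) → SweepShape.bottom S ≼⁺ D
  bottom≼⁺ {D = D} {T} hw S = subst (_≼⁺ D) (sym bottom≡) (∪⟦⟧-≼⁺ (head⊥ T) D letter letter≤n letter∉ (head⊥-≼ hw))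
    where open SweepShape S

  sweep-shape : ∀ {n} (T : List (Subset n)) x → HighestWeight T → x ≤ n → SweepShape T (sweep T ⟦ x ⟧)
  sweep-shape {n} [] x _ x≤n = record
    { bottom = ⟦ x ⟧ ; rest = [] ; letter = x ; shape = refl ; highestWeight = [-]
    ; bottom≡ = sym (∪-identityˡ ⟦ x ⟧) ; letter∉ = λ k _ → ∉⊥ {n} k ; letter≤n = x≤n ; strict = strict }
    where
    strict : Strict {n} x ⊥ ⟦ x ⟧
    strict t t<x rewrite count≥-⊥ {n} t | count≥-⟦⟧ x t x≤n | 𝟙<≡1 t<x = z<s
  sweep-shape (D ∷ T) x hw x≤n = record
    { bottom = D ∪ ⟦ violation bottom D ⟧ ; rest = (bottom ∩ ∁ ⟦ violation bottom D ⟧) ∷ rest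
    ; letter = violation bottom D ; shape = cong (moveDown D) shape
    ; highestWeight = ∖violation≼∪violation bottom D bottom≼⁺D ∷
                      highestWeight-∖⟦⟧ bottom rest _ letter (violation∈ bottom D) v≤letter strict highestWeight
    ; bottom≡ = refl ; letter∉ = violation∉ bottom D ; letter≤n = violation≤n bottom D _ refl
    ; strict = strict-∖violation-∪violation bottom D bottom≼⁺D }
    where
    S = sweep-shape T x (Linked.tail hw) x≤n
    open SweepShape S
    bottom≼⁺D = bottom≼⁺ hw S
    v≤letter : violation bottom D ≤ letter
    v≤letter = ≤-from⇒violation≤ bottom D letter above
      where
      above : ∀ t → letter ≤ t → count≥ bottom t ≤ count≥ D t
      above t letter≤t rewrite bottom≡ | count≥-∪⟦⟧ (head⊥ T) letter letter≤n letter∉ t | 𝟙<≡0 letter≤t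
                             | +-identityʳ (count≥ (head⊥ T) t) = head⊥-≼ hw t

  sweep-highestWeight : ∀ {n} (T : List (Subset n)) x → HighestWeight T → x ≤ n → HighestWeight (sweep T ⟦ x ⟧)
  sweep-highestWeight T x hw x≤n = subst HighestWeight (sym shape) highestWeight
    where open SweepShape (sweep-shape T x hw x≤n)

module Tableau where

  open SuffixCounts
  open RowInsertion
  open Sweep

  tableau : ∀ {n} → ℕ → List (Subset n) → List (List ℕ)
  tableau zero    T = []
  tableau (suc f) T = tops T ∷ tableau f (dropTops T)

  tableau-sweep : ∀ {n} f (T : List (Subset n)) x → HighestWeight T → x ≤ n →
                  tableau f (sweep T ⟦ x ⟧) ≡ insertTableau (tableau f T) x
  tableau-sweep zero    T x hw x≤n = refl
  tableau-sweep (suc f) T x hw x≤n = cong₂ _∷_ (proj₁ inserted) (begin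
    tableau f (dropTops (sweep T ⟦ x ⟧))                ≡⟨ cong (tableau f) (proj₂ inserted) ⟩
    tableau f (sweep (dropTops T) ⟦ bump (tops T) x ⟧)  ≡⟨ tableau-sweep f (dropTops T) _ (highestWeight-dropTops hw) bump≤n ⟩
    insertTableau (tableau f (dropTops T)) (bump (tops T) x) ∎)
    where
    open ≡-Reasoning
    inserted = sweep-rowInsert T x hw x≤n
    bump≤n = bump≤ (tops T) x (All.map⁺ (All.universal top≤n T))

  tableau-decreasing : ∀ {n} f (T : List (Subset n)) → HighestWeight T → All Decreasing (tableau f T)
  tableau-decreasing zero    T hw = []
  tableau-decreasing (suc f) T hw = tops-decreasing hw ∷ tableau-decreasing f (dropTops T) (highestWeight-dropTops hw)

  tops-dropTops-injective : ∀ {n} (T T′ : List (Subset n)) → tops T ≡ tops T′ → dropTops T ≡ dropTops T′ → T ≡ T′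
  tops-dropTops-injective []      []        _    _     = refl
  tops-dropTops-injective (C ∷ T) (C′ ∷ T′) tops≡ drops≡
    with ∷-injective tops≡ | ∷-injective drops≡
  ... | top≡ , tops≡′ | drop≡ , drops≡′ = cong₂ _∷_ (begin
    C                        ≡⟨ dropTop-∪-top C ⟨
    dropTop C ∪ ⟦ top C ⟧    ≡⟨ cong₂ (λ A t → A ∪ ⟦ t ⟧) drop≡ top≡ ⟩
    dropTop C′ ∪ ⟦ top C′ ⟧  ≡⟨ dropTop-∪-top C′ ⟩
    C′                       ∎) (tops-dropTops-injective T T′ tops≡′ drops≡′)
    where open ≡-Reasoning

  count≥0≡0⇒≡⊥ : ∀ {n} (C : Subset n) → count≥ C 0 ≤ 0 → C ≡ ⊥
  count≥0≡0⇒≡⊥ {n} C C≤0 =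
    count≥-injective C ⊥ (λ t → trans (n≤0⇒n≡0 (≤-trans (count≥-antitone C z≤n) C≤0)) (sym (count≥-⊥ {n} t)))

  Sized : ∀ {n} → ℕ → List (Subset n) → Set
  Sized f = All (λ C → count≥ C 0 ≤ f)

  sized-dropTops : ∀ {n} f (T : List (Subset n)) → Sized (suc f) T → Sized f (dropTops T)
  sized-dropTops f T sized = All.map⁺ (All.map (λ {C} C≤ → subst (_≤ f) (sym (count≥-dropTop C 0)) (∸-monoˡ-≤ 1 C≤)) sized)

  tableau-injective : ∀ {n} f (T T′ : List (Subset n)) → Sized f T → Sized f T′ →
                      tableau (suc f) T ≡ tableau (suc f) T′ → T ≡ T′
  tableau-injective zero T T′ sized sized′ eq = empty-injective T T′ sized sized′ (∷-injectiveˡ eq)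
    where
    empty-injective : ∀ T T′ → Sized 0 T → Sized 0 T′ → tops T ≡ tops T′ → T ≡ T′
    empty-injective []      []        _          _            _     = refl
    empty-injective (C ∷ T) (C′ ∷ T′) (C≤ ∷ T≤) (C′≤ ∷ T′≤) tops≡ =
      cong₂ _∷_ (trans (count≥0≡0⇒≡⊥ C C≤) (sym (count≥0≡0⇒≡⊥ C′ C′≤)))
                (empty-injective T T′ T≤ T′≤ (∷-injectiveʳ tops≡))
  tableau-injective (suc f) T T′ sized sized′ eq =
    tops-dropTops-injective T T′ (∷-injectiveˡ eq)
      (tableau-injective f (dropTops T) (dropTops T′) (sized-dropTops f T sized) (sized-dropTops f T′ sized′) (∷-injectiveʳ eq))

  sweep3 : ∀ {n} → List (Subset n) → Triple → List (Subset n)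
  sweep3 T (x , y , z) = sweep (sweep (sweep T ⟦ x ⟧) ⟦ y ⟧) ⟦ z ⟧

  tableau-sweep3 : ∀ {n} f (T : List (Subset n)) p → HighestWeight T → Triple≤ p n →
                   tableau f (sweep3 T p) ≡ insertTableau3 (tableau f T) p
  tableau-sweep3 f T (x , y , z) hw (x≤ , y≤ , z≤) = begin
    tableau f (sweep (sweep Tx ⟦ y ⟧) ⟦ z ⟧)           ≡⟨ tableau-sweep f (sweep Tx ⟦ y ⟧) z (sweep-highestWeight Tx y hwx y≤) z≤ ⟩
    insertTableau (tableau f (sweep Tx ⟦ y ⟧)) z       ≡⟨ cong (λ P → insertTableau P z) (tableau-sweep f Tx y hwx y≤) ⟩
    insertTableau (insertTableau (tableau f Tx) y) z   ≡⟨ cong (λ P → insertTableau (insertTableau P y) z) (tableau-sweep f T x hw x≤) ⟩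
    insertTableau3 (tableau f T) (x , y , z)           ∎
    where
    open ≡-Reasoning
    Tx = sweep T ⟦ x ⟧
    hwx = sweep-highestWeight T x hw x≤

  sweep3-knuth : ∀ {n} (T : List (Subset n)) p q → HighestWeight T → Triple≤ p n → Triple≤ q n → Knuth3 p q →
                 sweep3 T p ≡ sweep3 T q
  sweep3-knuth {n} T p q hw p≤n q≤n knuth = tableau-injective n (sweep3 T p) (sweep3 T q) (sized _) (sized _) (begin
    tableau (suc n) (sweep3 T p)                 ≡⟨ tableau-sweep3 (suc n) T p hw p≤n ⟩
    insertTableau3 (tableau (suc n) T) p         ≡⟨ insertTableau3-knuth (tableau (suc n) T) (tableau-decreasing (suc n) T hw) knuth ⟩
    insertTableau3 (tableau (suc n) T) q         ≡⟨ tableau-sweep3 (suc n) T q hw q≤n ⟨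
    tableau (suc n) (sweep3 T q)                 ∎)
    where
    open ≡-Reasoning
    sized : ∀ T′ → Sized n T′
    sized = All.universal (λ C → count≥≤n C 0)

module ColumnWord where

  open SuffixCounts

  unmatchedCount : ∀ {n} → ℕ → List (Fin n) → List (ℕ × Fin n) → ℕ
  unmatchedCount i st [] = 0
  unmatchedCount i st ((r , j) ∷ xs) with r ≟ suc i
  ... | yes _ = unmatchedCount i (j ∷ st) xs
  ... | no _ with r ≟ i
  ...   | no _ = unmatchedCount i st xs
  ...   | yes _ with st
  ...     | []     = suc (unmatchedCount i [] xs)
  ...     | _ ∷ st′ = unmatchedCount i st′ xs

  unmatchedGo-++ : ∀ {n} i (st : List (Fin n)) L₁ L₂ →
                   unmatchedGo i st (L₁ ++ L₂) ≡ unmatchedGo i (unmatchedGo i st L₁) L₂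
  unmatchedGo-++ i st []              L₂ = refl
  unmatchedGo-++ i st ((r , j) ∷ L₁) L₂ with r ≟ suc i
  ... | yes _ = unmatchedGo-++ i (j ∷ st) L₁ L₂
  ... | no _ with r ≟ i
  ...   | no _ = unmatchedGo-++ i st L₁ L₂
  ...   | yes _ with st
  ...     | []     = unmatchedGo-++ i [] L₁ L₂
  ...     | _ ∷ st′ = unmatchedGo-++ i st′ L₁ L₂

  unmatchedCount-++ : ∀ {n} i (st : List (Fin n)) L₁ L₂ →
                      unmatchedCount i st (L₁ ++ L₂) ≡ unmatchedCount i st L₁ + unmatchedCount i (unmatchedGo i st L₁) L₂
  unmatchedCount-++ i st []              L₂ = refl
  unmatchedCount-++ i st ((r , j) ∷ L₁) L₂ with r ≟ suc i
  ... | yes _ = unmatchedCount-++ i (j ∷ st) L₁ L₂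
  ... | no _ with r ≟ i
  ...   | no _ = unmatchedCount-++ i st L₁ L₂
  ...   | yes _ with st
  ...     | []     = cong suc (unmatchedCount-++ i [] L₁ L₂)
  ...     | _ ∷ st′ = unmatchedCount-++ i st′ L₁ L₂

  drop-∷ : ∀ {A : Set} c (j : A) st → drop c (j ∷ st) ≡ drop c (j ∷ []) ++ drop (c ∸ 1) st
  drop-∷ zero    j st = refl
  drop-∷ (suc c) j st = sym (cong (_++ drop c st) (drop-[] c))

  unmatchedCount-stack : ∀ {n} i (st : List (Fin n)) L → unmatchedCount i st L ≡ unmatchedCount i [] L ∸ length st
  unmatchedCount-stack i st [] = sym (0∸n≡0 (length st))
  unmatchedCount-stack i st ((r , j) ∷ L) with r ≟ suc i
  ... | yes _ = begin
    unmatchedCount i (j ∷ st) L              ≡⟨ unmatchedCount-stack i (j ∷ st) L ⟩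
    unmatchedCount i [] L ∸ (1 + length st)  ≡⟨ ∸-+-assoc (unmatchedCount i [] L) 1 (length st) ⟨
    unmatchedCount i [] L ∸ 1 ∸ length st    ≡⟨ cong (_∸ length st) (unmatchedCount-stack i (j ∷ []) L) ⟨
    unmatchedCount i (j ∷ []) L ∸ length st  ∎
    where open ≡-Reasoning
  ... | no _ with r ≟ i
  ...   | no _ = unmatchedCount-stack i st L
  ...   | yes _ with st
  ...     | []     = refl
  ...     | _ ∷ st′ = unmatchedCount-stack i st′ L

  -- Scanning from a nonempty stack: the unmatched letters i pop the old stack.
  unmatchedGo-stack : ∀ {n} i (st : List (Fin n)) L → unmatchedGo i st L ≡ unmatchedGo i [] L ++ drop (unmatchedCount i [] L) st
  unmatchedGo-stack i st [] = refl
  unmatchedGo-stack i st ((r , j) ∷ L) with r ≟ suc i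
  ... | yes _ = begin
    unmatchedGo i (j ∷ st) L                            ≡⟨ unmatchedGo-stack i (j ∷ st) L ⟩
    U ++ drop c (j ∷ st)                                ≡⟨ cong (U ++_) (drop-∷ c j st) ⟩
    U ++ (drop c (j ∷ []) ++ drop (c ∸ 1) st)           ≡⟨ ++-assoc U (drop c (j ∷ [])) (drop (c ∸ 1) st) ⟨
    (U ++ drop c (j ∷ [])) ++ drop (c ∸ 1) st           ≡⟨ cong₂ _++_ (unmatchedGo-stack i (j ∷ []) L)
                                                             (cong (λ c′ → drop c′ st) (unmatchedCount-stack i (j ∷ []) L)) ⟨
    unmatchedGo i (j ∷ []) L ++ drop (unmatchedCount i (j ∷ []) L) st ∎
    where
    open ≡-Reasoning
    U = unmatchedGo i [] L
    c = unmatchedCount i [] L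
  ... | no _ with r ≟ i
  ...   | no _ = unmatchedGo-stack i st L
  ...   | yes _ with st
  ...     | []     = sym (++-identityʳ _)
  ...     | _ ∷ st′ = unmatchedGo-stack i st′ L

  shiftColumn : ∀ {n} → ℕ × Fin n → ℕ × Fin (suc n)
  shiftColumn (r , j) = r , suc j

  unmatchedGo-shift : ∀ {n} i (st : List (Fin n)) L →
                      unmatchedGo i (map suc st) (map shiftColumn L) ≡ map suc (unmatchedGo i st L)
  unmatchedGo-shift i st [] = refl
  unmatchedGo-shift i st ((r , j) ∷ L) with r ≟ suc i
  ... | yes _ = unmatchedGo-shift i (j ∷ st) L
  ... | no _ with r ≟ i
  ...   | no _ = unmatchedGo-shift i st L
  ...   | yes _ with st
  ...     | []     = unmatchedGo-shift i [] L
  ...     | _ ∷ st′ = unmatchedGo-shift i st′ L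

  unmatchedCount-shift : ∀ {n} i (st : List (Fin n)) L →
                         unmatchedCount i (map suc st) (map shiftColumn L) ≡ unmatchedCount i st L
  unmatchedCount-shift i st [] = refl
  unmatchedCount-shift i st ((r , j) ∷ L) with r ≟ suc i
  ... | yes _ = unmatchedCount-shift i (j ∷ st) L
  ... | no _ with r ≟ i
  ...   | no _ = unmatchedCount-shift i st L
  ...   | yes _ with st
  ...     | []     = cong suc (unmatchedCount-shift i [] L)
  ...     | _ ∷ st′ = unmatchedCount-shift i st′ L

  indexedFrom : ∀ {X : Set} → ℕ → List X → List (ℕ × X)
  indexedFrom k []      = []
  indexedFrom k (S ∷ B) = (k , S) ∷ indexedFrom (suc k) B

  zip-applyUpTo : ∀ {X : Set} (f : ℕ → ℕ) k (B : List X) → (∀ i → f i ≡ k + i) →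
                  zip (map suc (applyUpTo f (length B))) B ≡ indexedFrom (suc k) B
  zip-applyUpTo f k []      f≗k+ = refl
  zip-applyUpTo f k (S ∷ B) f≗k+ =
    cong₂ _∷_ (cong (λ z → suc z , S) (trans (f≗k+ 0) (+-identityʳ k)))
              (zip-applyUpTo (f ∘ suc) (suc k) B (λ i → trans (f≗k+ (suc i)) (+-suc k i)))

  indexed≡indexedFrom : ∀ {n} (B : Balls n) → indexed B ≡ indexedFrom 1 B
  indexed≡indexedFrom B = zip-applyUpTo id 0 B (λ i → refl)

  ballAt : ∀ {n} → Fin n → ℕ × Subset n → List (ℕ × Fin n)
  ballAt j (r , S) = if lookup S j then (r , j) ∷ [] else []

  concatMap-tabulate-suc : ∀ {A : Set} {n m} (h : Fin (suc n) → List A) (g : Fin m → Fin n) →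
                           concatMap h (tabulate (suc ∘ g)) ≡ concatMap (h ∘ suc) (tabulate g)
  concatMap-tabulate-suc {m = zero}  h g = refl
  concatMap-tabulate-suc {m = suc m} h g = cong (h (suc (g zero)) ++_) (concatMap-tabulate-suc h (g ∘ suc))

  tailRow : ∀ {n} → ℕ × Subset (suc n) → ℕ × Subset n
  tailRow (r , S) = r , Vec.tail S

  indexedFrom-tail : ∀ {n} k (B : Balls (suc n)) → indexedFrom k (map Vec.tail B) ≡ map tailRow (indexedFrom k B)
  indexedFrom-tail k []      = refl
  indexedFrom-tail k (S ∷ B) = cong ((k , Vec.tail S) ∷_) (indexedFrom-tail (suc k) B)

  ballAt-suc : ∀ {n} (j : Fin n) (L : List (ℕ × Subset (suc n))) →
               concatMap (ballAt (suc j)) L ≡ map shiftColumn (concatMap (ballAt j) (map tailRow L))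
  ballAt-suc j [] = refl
  ballAt-suc j ((r , (s ∷ S)) ∷ L) with lookup S j
  ... | true  = cong ((r , suc j) ∷_) (ballAt-suc j L)
  ... | false = ballAt-suc j L

  cwTagged-split : ∀ {n} (B : Balls (suc n)) →
                   cwTagged B ≡ concatMap (ballAt zero) (reverse (indexed B)) ++ map shiftColumn (cwTagged (map Vec.tail B))
  cwTagged-split {n} B = cong (concatMap (ballAt zero) R ++_) (begin
    concatMap (λ j → concatMap (ballAt j) R) (tabulate suc)            ≡⟨ concatMap-tabulate-suc (λ j → concatMap (ballAt j) R) id ⟩
    concatMap (λ j → concatMap (ballAt (suc j)) R) (allFin n)          ≡⟨ concatMap-cong shifted (allFin n) ⟩
    concatMap (λ j → map shiftColumn (concatMap (ballAt j) R′)) (allFin n) ≡⟨ map-concatMap shiftColumn (λ j → concatMap (ballAt j) R′) (allFin n) ⟨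
    map shiftColumn (cwTagged (map Vec.tail B))                        ∎)
    where
    open ≡-Reasoning
    R  = reverse (indexed B)
    R′ = reverse (indexed (map Vec.tail B))
    tails : map tailRow R ≡ R′
    tails = begin
      map tailRow (reverse (indexed B))             ≡⟨ reverse-map tailRow (indexed B) ⟩
      reverse (map tailRow (indexed B))             ≡⟨ cong (reverse ∘ map tailRow) (indexed≡indexedFrom B) ⟩
      reverse (map tailRow (indexedFrom 1 B))       ≡⟨ cong reverse (indexedFrom-tail 1 B) ⟨
      reverse (indexedFrom 1 (map Vec.tail B))      ≡⟨ cong reverse (indexed≡indexedFrom (map Vec.tail B)) ⟨
      R′                                            ∎
    shifted : ∀ j → concatMap (ballAt (suc j)) R ≡ map shiftColumn (concatMap (ballAt j) R′)
    shifted j = trans (ballAt-suc j R) (cong (map shiftColumn ∘ concatMap (ballAt j)) tails)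

  -- Row r of B, when its first row is numbered k.
  rowAt : ∀ {n} → ℕ → Balls n → ℕ → Subset n
  rowAt k []      r = ⊥
  rowAt k (S ∷ B) r with r ≟ k
  ... | yes _ = S
  ... | no _  = rowAt (suc k) B r

  rowAt-hit : ∀ {n} k (S : Subset n) B → rowAt k (S ∷ B) k ≡ S
  rowAt-hit k S B with k ≟ k
  ... | yes _  = refl
  ... | no k≢k = ⊥-elim (k≢k refl)

  rowAt-miss : ∀ {n} k r (S : Subset n) B → r ≢ k → rowAt k (S ∷ B) r ≡ rowAt (suc k) B r
  rowAt-miss k r S B r≢k with r ≟ k
  ... | yes r≡k = ⊥-elim (r≢k r≡k)
  ... | no _    = refl

  rowAt-low : ∀ {n} k r (B : Balls n) → r < k → rowAt k B r ≡ ⊥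
  rowAt-low k r []      r<k = refl
  rowAt-low k r (S ∷ B) r<k with r ≟ k
  ... | yes r≡k = ⊥-elim (<-irrefl r≡k r<k)
  ... | no _    = rowAt-low (suc k) r B (m≤n⇒m≤1+n r<k)

  rowAt-shift : ∀ {n} k r (B : Balls n) → rowAt (suc k) B (suc r) ≡ rowAt k B r
  rowAt-shift k r [] = refl
  rowAt-shift k r (S ∷ B) with suc r ≟ suc k | r ≟ k
  ... | yes _   | yes _   = refl
  ... | no _    | no _    = rowAt-shift (suc k) r B
  ... | yes 1+r≡1+k | no r≢k = ⊥-elim (r≢k (suc-injective 1+r≡1+k))
  ... | no 1+r≢1+k  | yes r≡k = ⊥-elim (1+r≢1+k (cong suc r≡k))

  rowAt-tail : ∀ {n} k r (B : Balls (suc n)) → rowAt k (map Vec.tail B) r ≡ Vec.tail (rowAt k B r)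
  rowAt-tail k r [] = refl
  rowAt-tail k r (S ∷ B) with r ≟ k
  ... | yes _ = refl
  ... | no _  = rowAt-tail (suc k) r B

  pushIf : ∀ {n} → Bool → List (Fin (suc n)) → List (Fin (suc n))
  pushIf true  st = zero ∷ st
  pushIf false st = st

  popIf : ∀ {A : Set} → Bool → List A → List A
  popIf false st       = st
  popIf true  []       = []
  popIf true  (_ ∷ st) = st

  unmatchedIf : ∀ {A : Set} → Bool → List A → ℕ
  unmatchedIf true  []      = 1
  unmatchedIf true  (_ ∷ _) = 0
  unmatchedIf false _       = 0

  column₀ : ∀ {n} → ℕ → Balls (suc n) → List (ℕ × Fin (suc n))
  column₀ k B = concatMap (ballAt zero) (reverse (indexedFrom k B))

  column₀-∷ : ∀ {n} k (S : Subset (suc n)) B → column₀ k (S ∷ B) ≡ column₀ (suc k) B ++ ballAt zero (k , S)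
  column₀-∷ k S B = begin
    concatMap (ballAt zero) (reverse ((k , S) ∷ I))          ≡⟨ cong (concatMap (ballAt zero)) (unfold-reverse (k , S) I) ⟩
    concatMap (ballAt zero) (reverse I ∷ʳ (k , S))           ≡⟨ concatMap-++ (ballAt zero) (reverse I) ((k , S) ∷ []) ⟩
    column₀ (suc k) B ++ (ballAt zero (k , S) ++ [])         ≡⟨ cong (column₀ (suc k) B ++_) (++-identityʳ (ballAt zero (k , S))) ⟩
    column₀ (suc k) B ++ ballAt zero (k , S)                 ∎
    where
    open ≡-Reasoning
    I = indexedFrom (suc k) B

  i≢1+i : ∀ i → i ≢ suc i
  i≢1+i i = 1+n≢n ∘ sym

  unmatchedGo-upper : ∀ {n} i (S : Subset (suc n)) st → unmatchedGo i st (ballAt zero (suc i , S)) ≡ pushIf (Vec.head S) st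
  unmatchedGo-upper i (true ∷ S) st with suc i ≟ suc i
  ... | yes _  = refl
  ... | no i≢i = ⊥-elim (i≢i refl)
  unmatchedGo-upper i (false ∷ S) st = refl

  unmatchedCount-upper : ∀ {n} i (S : Subset (suc n)) st → unmatchedCount i st (ballAt zero (suc i , S)) ≡ 0
  unmatchedCount-upper i (true ∷ S) st with suc i ≟ suc i
  ... | yes _  = refl
  ... | no i≢i = ⊥-elim (i≢i refl)
  unmatchedCount-upper i (false ∷ S) st = refl

  unmatchedGo-lower : ∀ {n} i (S : Subset (suc n)) st → unmatchedGo i st (ballAt zero (i , S)) ≡ popIf (Vec.head S) st
  unmatchedGo-lower i (true ∷ S) st with i ≟ suc i
  ... | yes i≡1+i = ⊥-elim (i≢1+i i i≡1+i)
  ... | no _ with i ≟ i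
  ...   | no i≢i = ⊥-elim (i≢i refl)
  ...   | yes _ with st
  ...     | []    = refl
  ...     | _ ∷ _ = refl
  unmatchedGo-lower i (false ∷ S) st = refl

  unmatchedCount-lower : ∀ {n} i (S : Subset (suc n)) st → unmatchedCount i st (ballAt zero (i , S)) ≡ unmatchedIf (Vec.head S) st
  unmatchedCount-lower i (true ∷ S) st with i ≟ suc i
  ... | yes i≡1+i = ⊥-elim (i≢1+i i i≡1+i)
  ... | no _ with i ≟ i
  ...   | no i≢i = ⊥-elim (i≢i refl)
  ...   | yes _ with st
  ...     | []    = refl
  ...     | _ ∷ _ = refl
  unmatchedCount-lower i (false ∷ S) st = refl

  unmatchedGo-other : ∀ {n} i k (S : Subset (suc n)) st → k ≢ suc i → k ≢ i → unmatchedGo i st (ballAt zero (k , S)) ≡ st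
  unmatchedGo-other i k (true ∷ S) st k≢1+i k≢i with k ≟ suc i
  ... | yes k≡1+i = ⊥-elim (k≢1+i k≡1+i)
  ... | no _ with k ≟ i
  ...   | yes k≡i = ⊥-elim (k≢i k≡i)
  ...   | no _    = refl
  unmatchedGo-other i k (false ∷ S) st _ _ = refl

  unmatchedCount-other : ∀ {n} i k (S : Subset (suc n)) st → k ≢ suc i → k ≢ i → unmatchedCount i st (ballAt zero (k , S)) ≡ 0
  unmatchedCount-other i k (true ∷ S) st k≢1+i k≢i with k ≟ suc i
  ... | yes k≡1+i = ⊥-elim (k≢1+i k≡1+i)
  ... | no _ with k ≟ i
  ...   | yes k≡i = ⊥-elim (k≢i k≡i)
  ...   | no _    = refl
  unmatchedCount-other i k (false ∷ S) st _ _ = refl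

  -- Column 0 is read top to bottom, so the letter i+1 there is pushed before the letter i pops.
  unmatchedGo-column₀ : ∀ {n} i k (B : Balls (suc n)) st →
                        unmatchedGo i st (column₀ k B) ≡ popIf (Vec.head (rowAt k B i)) (pushIf (Vec.head (rowAt k B (suc i))) st)
  unmatchedGo-column₀ i k [] st = refl
  unmatchedGo-column₀ i k (S ∷ B) st
    rewrite column₀-∷ k S B | unmatchedGo-++ i st (column₀ (suc k) B) (ballAt zero (k , S))
          | unmatchedGo-column₀ i (suc k) B st
    with k ≟ suc i
  ... | yes refl
    rewrite rowAt-low (suc (suc i)) i B (n≤1+n (suc i)) | rowAt-low (suc (suc i)) (suc i) B ≤-refl
          | rowAt-hit (suc i) S B | rowAt-miss (suc i) i S B (i≢1+i i)
          | rowAt-low (suc (suc i)) i B (n≤1+n (suc i)) = unmatchedGo-upper i S st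
  ... | no k≢1+i with k ≟ i
  ...   | yes refl
    rewrite rowAt-low (suc k) k B ≤-refl | rowAt-hit k S B | rowAt-miss k (suc k) S B 1+n≢n =
    unmatchedGo-lower k S (pushIf (Vec.head (rowAt (suc k) B (suc k))) st)
  ...   | no k≢i
    rewrite rowAt-miss k i S B (k≢i ∘ sym) | rowAt-miss k (suc i) S B (k≢1+i ∘ sym) = unmatchedGo-other i k S _ k≢1+i k≢i

  unmatchedCount-column₀ : ∀ {n} i k (B : Balls (suc n)) st →
                           unmatchedCount i st (column₀ k B) ≡ unmatchedIf (Vec.head (rowAt k B i)) (pushIf (Vec.head (rowAt k B (suc i))) st)
  unmatchedCount-column₀ i k [] st = refl
  unmatchedCount-column₀ i k (S ∷ B) st
    rewrite column₀-∷ k S B | unmatchedCount-++ i st (column₀ (suc k) B) (ballAt zero (k , S))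
          | unmatchedGo-column₀ i (suc k) B st | unmatchedCount-column₀ i (suc k) B st
    with k ≟ suc i
  ... | yes refl
    rewrite rowAt-low (suc (suc i)) i B (n≤1+n (suc i)) | rowAt-low (suc (suc i)) (suc i) B ≤-refl
          | rowAt-hit (suc i) S B | rowAt-miss (suc i) i S B (i≢1+i i)
          | rowAt-low (suc (suc i)) i B (n≤1+n (suc i)) = unmatchedCount-upper i S st
  ... | no k≢1+i with k ≟ i
  ...   | yes refl
    rewrite rowAt-low (suc k) k B ≤-refl | rowAt-hit k S B | rowAt-miss k (suc k) S B 1+n≢n =
    unmatchedCount-lower k S (pushIf (Vec.head (rowAt (suc k) B (suc k))) st)
  ...   | no k≢i
    rewrite rowAt-miss k i S B (k≢i ∘ sym) | rowAt-miss k (suc i) S B (k≢1+i ∘ sym)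
          | unmatchedCount-other i k S (popIf (Vec.head (rowAt (suc k) B i)) (pushIf (Vec.head (rowAt (suc k) B (suc i))) st)) k≢1+i k≢i =
    +-identityʳ _

  unmatchedStep : Bool → Bool → ℕ → Bool
  unmatchedStep y d c = y ∧ not d ∧ (c ≡ᵇ 0)

  countStep : Bool → Bool → ℕ → ℕ
  countStep y d c = bit (not y ∧ d) + (c ∸ bit (y ∧ not d))

  -- Par_i for the rows Y (letters i+1) and D (letters i), one column at a time: the set of
  -- unmatched letters i+1 and the number of unmatched letters i. In the first column a lone
  -- letter i+1 is matched by the first unmatched letter i of the remaining columns, if any.
  matchColumns : ∀ {n} → Subset n → Subset n → Subset n × ℕ
  matchColumns []      []      = [] , 0
  matchColumns (y ∷ Y) (d ∷ D) =
    unmatchedStep y d (proj₂ (matchColumns Y D)) ∷ proj₁ (matchColumns Y D) , countStep y d (proj₂ (matchColumns Y D))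

  toSubset-++ : ∀ {n} (xs ys : List (Fin n)) → toSubset (xs ++ ys) ≡ toSubset xs ∪ toSubset ys
  toSubset-++ []       ys = sym (∪-identityˡ (toSubset ys))
  toSubset-++ (x ∷ xs) ys = trans (cong (⁅ x ⁆ ∪_) (toSubset-++ xs ys)) (sym (∪-assoc ⁅ x ⁆ (toSubset xs) (toSubset ys)))

  toSubset-map-suc : ∀ {n} (xs : List (Fin n)) → toSubset (map suc xs) ≡ false ∷ toSubset xs
  toSubset-map-suc []       = refl
  toSubset-map-suc (x ∷ xs) = cong ((false ∷ ⁅ x ⁆) ∪_) (toSubset-map-suc xs)

  column₀Stack : ∀ {n} → Bool → Bool → List (Fin (suc n))
  column₀Stack y d = popIf d (pushIf y [])

  column₀Stack-length : ∀ {n} y d → length (column₀Stack {n} y d) ≡ bit (y ∧ not d)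
  column₀Stack-length true  true  = refl
  column₀Stack-length true  false = refl
  column₀Stack-length false true  = refl
  column₀Stack-length false false = refl

  unmatchedIf-column₀ : ∀ {n} y d → unmatchedIf {Fin (suc n)} d (pushIf y []) ≡ bit (not y ∧ d)
  unmatchedIf-column₀ true  true  = refl
  unmatchedIf-column₀ true  false = refl
  unmatchedIf-column₀ false true  = refl
  unmatchedIf-column₀ false false = refl

  toSubset-drop-column₀Stack : ∀ {n} y d c → toSubset (drop c (column₀Stack {n} y d)) ≡ unmatchedStep y d c ∷ ⊥
  toSubset-drop-column₀Stack true  false zero    = cong (true ∷_) (∪-identityʳ ⊥)
  toSubset-drop-column₀Stack true  false (suc c) = cong toSubset (drop-[] c)
  toSubset-drop-column₀Stack true  true  zero    = refl
  toSubset-drop-column₀Stack true  true  (suc c) = refl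
  toSubset-drop-column₀Stack false true  zero    = refl
  toSubset-drop-column₀Stack false true  (suc c) = refl
  toSubset-drop-column₀Stack false false zero    = refl
  toSubset-drop-column₀Stack false false (suc c) = refl

  head∷tail : ∀ {A : Set} {n} (v : Vec A (suc n)) → v ≡ Vec.head v ∷ Vec.tail v
  head∷tail (x ∷ v) = refl

  unmatched≡matchColumns : ∀ {n} i (B : Balls n) →
                           (toSubset (unmatchedGo i [] (cwTagged B)) , unmatchedCount i [] (cwTagged B)) ≡
                           matchColumns (rowAt 1 B (suc i)) (rowAt 1 B i)
  unmatched≡matchColumns {zero} i B with rowAt 1 B (suc i) | rowAt 1 B i
  ... | [] | [] = refl
  unmatched≡matchColumns {suc n} i B = begin
    (toSubset (unmatchedGo i [] (cwTagged B)) , unmatchedCount i [] (cwTagged B))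
      ≡⟨ cong₂ _,_ set-eq count-eq ⟩
    (unmatchedStep y d c ∷ toSubset U , countStep y d c)
      ≡⟨ cong (λ P → unmatchedStep y d (proj₂ P) ∷ proj₁ P , countStep y d (proj₂ P)) IH ⟩
    matchColumns (y ∷ Vec.tail Y) (d ∷ Vec.tail D)
      ≡⟨ cong₂ matchColumns (head∷tail Y) (head∷tail D) ⟨
    matchColumns Y D
      ∎
    where
    open ≡-Reasoning
    Y = rowAt 1 B (suc i)
    D = rowAt 1 B i
    y = Vec.head Y
    d = Vec.head D
    M = cwTagged (map Vec.tail B)
    U = unmatchedGo i [] M
    c = unmatchedCount i [] M
    st : List (Fin (suc n))
    st = column₀Stack y d
    IH : (toSubset U , c) ≡ matchColumns (Vec.tail Y) (Vec.tail D)
    IH = trans (unmatched≡matchColumns i (map Vec.tail B)) (cong₂ matchColumns (rowAt-tail 1 (suc i) B) (rowAt-tail 1 i B))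
    split : cwTagged B ≡ column₀ 1 B ++ map shiftColumn M
    split = trans (cwTagged-split B) (cong (λ L → concatMap (ballAt zero) (reverse L) ++ map shiftColumn M) (indexed≡indexedFrom B))
    stack-eq : unmatchedGo i [] (cwTagged B) ≡ map suc U ++ drop c st
    stack-eq = begin
      unmatchedGo i [] (cwTagged B)
        ≡⟨ trans (cong (unmatchedGo i []) split) (unmatchedGo-++ i [] (column₀ 1 B) (map shiftColumn M)) ⟩
      unmatchedGo i (unmatchedGo i [] (column₀ 1 B)) (map shiftColumn M)
        ≡⟨ cong (λ s → unmatchedGo i s (map shiftColumn M)) (unmatchedGo-column₀ i 1 B []) ⟩
      unmatchedGo i st (map shiftColumn M)
        ≡⟨ unmatchedGo-stack i st (map shiftColumn M) ⟩
      unmatchedGo i [] (map shiftColumn M) ++ drop (unmatchedCount i [] (map shiftColumn M)) st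
        ≡⟨ cong₂ (λ u c′ → u ++ drop c′ st) (unmatchedGo-shift i [] M) (unmatchedCount-shift i [] M) ⟩
      map suc U ++ drop c st
        ∎
    set-eq : toSubset (unmatchedGo i [] (cwTagged B)) ≡ unmatchedStep y d c ∷ toSubset U
    set-eq = begin
      toSubset (unmatchedGo i [] (cwTagged B))          ≡⟨ cong toSubset stack-eq ⟩
      toSubset (map suc U ++ drop c st)                 ≡⟨ toSubset-++ (map suc U) (drop c st) ⟩
      toSubset (map suc U) ∪ toSubset (drop c st)       ≡⟨ cong₂ _∪_ (toSubset-map-suc U) (toSubset-drop-column₀Stack y d c) ⟩
      (false ∷ toSubset U) ∪ (unmatchedStep y d c ∷ ⊥)  ≡⟨ cong (unmatchedStep y d c ∷_) (∪-identityʳ (toSubset U)) ⟩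
      unmatchedStep y d c ∷ toSubset U                  ∎
    count-eq : unmatchedCount i [] (cwTagged B) ≡ countStep y d c
    count-eq = begin
      unmatchedCount i [] (cwTagged B)
        ≡⟨ trans (cong (unmatchedCount i []) split) (unmatchedCount-++ i [] (column₀ 1 B) (map shiftColumn M)) ⟩
      unmatchedCount i [] (column₀ 1 B) + unmatchedCount i (unmatchedGo i [] (column₀ 1 B)) (map shiftColumn M)
        ≡⟨ cong₂ _+_ (trans (unmatchedCount-column₀ i 1 B []) (unmatchedIf-column₀ y d))
                     (cong (λ s → unmatchedCount i s (map shiftColumn M)) (unmatchedGo-column₀ i 1 B [])) ⟩
      bit (not y ∧ d) + unmatchedCount i st (map shiftColumn M)
        ≡⟨ cong (bit (not y ∧ d) +_) (unmatchedCount-stack i st (map shiftColumn M)) ⟩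
      bit (not y ∧ d) + (unmatchedCount i [] (map shiftColumn M) ∸ length st)
        ≡⟨ cong₂ (λ c′ l → bit (not y ∧ d) + (c′ ∸ l)) (unmatchedCount-shift i [] M) (column₀Stack-length y d) ⟩
      countStep y d c
        ∎

  MatchSpec : ∀ {n} → Subset n → Subset n → Set
  MatchSpec Y D =
    (violation Y D ≡ 0 → proj₁ (matchColumns Y D) ≡ ⊥ × proj₂ (matchColumns Y D) + count≥ Y 0 ≡ count≥ D 0) ×
    (∀ s → violation Y D ≡ suc s → proj₁ (matchColumns Y D) ≡ ⟦ suc s ⟧ × proj₂ (matchColumns Y D) + count≥ Y 0 ≡ suc (count≥ D 0))

  matchStep-0-0 : ∀ {n} y d (U : Subset n) c nY nD → U ≡ ⊥ → c + nY ≡ nD → bit y + nY ≤ bit d + nD →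
                  unmatchedStep y d c ∷ U ≡ ⊥ {suc n} × countStep y d c + (bit y + nY) ≡ bit d + nD
  matchStep-0-0 true  false U zero    nY nD U≡⊥ c+nY≡nD le = ⊥-elim (<⇒≱ le (≤-reflexive (sym c+nY≡nD)))
  matchStep-0-0 true  false U (suc c) nY nD U≡⊥ c+nY≡nD le = cong (false ∷_) U≡⊥ , trans (+-suc c nY) c+nY≡nD
  matchStep-0-0 true  true  U c       nY nD U≡⊥ c+nY≡nD le = cong (false ∷_) U≡⊥ , trans (+-suc c nY) (cong suc c+nY≡nD)
  matchStep-0-0 false d     U c       nY nD U≡⊥ c+nY≡nD le =
    cong (false ∷_) U≡⊥ , trans (+-assoc (bit d) c nY) (cong (bit d +_) c+nY≡nD)

  matchStep-0-1 : ∀ {n} y d (U : Subset n) c nY nD → U ≡ ⊥ → c + nY ≡ nD → bit d + nD < bit y + nY →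
                  unmatchedStep y d c ∷ U ≡ ⟦_⟧ {suc n} 1 × countStep y d c + (bit y + nY) ≡ suc (bit d + nD)
  matchStep-0-1 false d     U c nY nD U≡⊥ c+nY≡nD lt =
    ⊥-elim (<⇒≱ lt (≤-trans (≤-trans (m≤n+m nY c) (≤-reflexive c+nY≡nD)) (m≤n+m nD (bit d))))
  matchStep-0-1 true  true  U c nY nD U≡⊥ c+nY≡nD lt = ⊥-elim (<⇒≱ lt (s≤s (≤-trans (m≤n+m nY c) (≤-reflexive c+nY≡nD))))
  matchStep-0-1 true  false U c nY nD U≡⊥ c+nY≡nD lt
    with ≤-antisym (≤-trans (m≤n+m nY c) (≤-reflexive c+nY≡nD)) (≤-pred lt)
  ... | refl with +-cancelʳ-≡ nY c 0 c+nY≡nD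
  ...   | refl = cong (true ∷_) U≡⊥ , refl

  matchStep-suc : ∀ {n} y d s (U : Subset n) c nY nD → U ≡ ⟦ suc s ⟧ → c + nY ≡ suc nD → bit y + nY ≤ suc (bit d + nD) →
                  unmatchedStep y d c ∷ U ≡ ⟦_⟧ {suc n} (suc (suc s)) × countStep y d c + (bit y + nY) ≡ suc (bit d + nD)
  matchStep-suc true  false s U zero    nY nD U≡ c+nY≡ le = ⊥-elim (1+n≰n (≤-trans (≤-reflexive (sym c+nY≡)) (≤-pred le)))
  matchStep-suc true  false s U (suc c) nY nD U≡ c+nY≡ le = cong (false ∷_) U≡ , trans (+-suc c nY) c+nY≡
  matchStep-suc true  true  s U c       nY nD U≡ c+nY≡ le = cong (false ∷_) U≡ , trans (+-suc c nY) (cong suc c+nY≡)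
  matchStep-suc false true  s U c       nY nD U≡ c+nY≡ le = cong (false ∷_) U≡ , cong suc c+nY≡
  matchStep-suc false false s U c       nY nD U≡ c+nY≡ le = cong (false ∷_) U≡ , c+nY≡

  matchColumns-spec : ∀ {n} (Y D : Subset n) → Y ≼⁺ D → MatchSpec Y D
  matchColumns-spec []      []      _     = (λ _ → refl , refl) , (λ s ())
  matchColumns-spec (y ∷ Y) (d ∷ D) Y≼⁺D = no-violation , violation-at
    where
    ih = matchColumns-spec Y D (Y≼⁺D ∘ suc)
    U = proj₁ (matchColumns Y D)
    c = proj₂ (matchColumns Y D)
    no-violation : violation (y ∷ Y) (d ∷ D) ≡ 0 →
                   proj₁ (matchColumns (y ∷ Y) (d ∷ D)) ≡ ⊥ × proj₂ (matchColumns (y ∷ Y) (d ∷ D)) + count≥ (y ∷ Y) 0 ≡ count≥ (d ∷ D) 0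
    no-violation e
      with violation Y D in e′ | count≥ (d ∷ D) 0 <ᵇ count≥ (y ∷ Y) 0 | <ᵇ-reflects-< (count≥ (d ∷ D) 0) (count≥ (y ∷ Y) 0)
    ... | zero | false | ofⁿ ¬lt = matchStep-0-0 y d U c (count≥ Y 0) (count≥ D 0) (proj₁ (proj₁ ih e′)) (proj₂ (proj₁ ih e′)) (≮⇒≥ ¬lt)
    violation-at : ∀ s → violation (y ∷ Y) (d ∷ D) ≡ suc s →
                   proj₁ (matchColumns (y ∷ Y) (d ∷ D)) ≡ ⟦ suc s ⟧ × proj₂ (matchColumns (y ∷ Y) (d ∷ D)) + count≥ (y ∷ Y) 0 ≡ suc (count≥ (d ∷ D) 0)
    violation-at s e
      with violation Y D in e′ | count≥ (d ∷ D) 0 <ᵇ count≥ (y ∷ Y) 0 | <ᵇ-reflects-< (count≥ (d ∷ D) 0) (count≥ (y ∷ Y) 0)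
    violation-at s refl | suc s′ | _    | _      =
      matchStep-suc y d s′ U c (count≥ Y 0) (count≥ D 0) (proj₁ (proj₂ ih s′ e′)) (proj₂ (proj₂ ih s′ e′)) (Y≼⁺D 0)
    violation-at s refl | zero   | true | ofʸ lt =
      matchStep-0-1 y d U c (count≥ Y 0) (count≥ D 0) (proj₁ (proj₁ ih e′)) (proj₂ (proj₁ ih e′)) lt

  matchColumns≡violation : ∀ {n} (Y D : Subset n) → Y ≼⁺ D → proj₁ (matchColumns Y D) ≡ ⟦ violation Y D ⟧
  matchColumns≡violation Y D Y≼⁺D with violation Y D in e
  ... | zero  = proj₁ (proj₁ (matchColumns-spec Y D Y≼⁺D) e)
  ... | suc s = proj₁ (proj₂ (matchColumns-spec Y D Y≼⁺D) s e)

module CrystalOperators where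

  open SuffixCounts
  open Sweep
  open ColumnWord

  -- The function moving the rows inside eStar is local to its definition; unification names it.
  mutual
    moveRow : ∀ {n} → ℕ → Balls n → ℕ × Subset n → Subset n
    moveRow i B = _

    eStar≡map-moveRow : ∀ {n} i (B : Balls n) → eStar i B ≡ map (moveRow i B) (indexed B)
    eStar≡map-moveRow i B = refl

  move : ∀ {n} → ℕ → Subset n → ℕ × Subset n → Subset n
  move i U (r , S) with r ≟ suc i
  ... | yes _ = S ∩ ∁ U
  ... | no _ with r ≟ i
  ...   | yes _ = S ∪ U
  ...   | no _  = S

  unmatchedSet : ∀ {n} → ℕ → Balls n → Subset n
  unmatchedSet i B = toSubset (unmatchedAbove i B)

  moveRow≡move : ∀ {n} i (B : Balls n) p → moveRow i B p ≡ move i (unmatchedSet i B) p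
  moveRow≡move i B (r , S) with r ≟ suc i
  ... | yes _ = refl
  ... | no _ with r ≟ i
  ...   | yes _ = refl
  ...   | no _  = refl

  eStar≡map-move : ∀ {n} i (B : Balls n) → eStar i B ≡ map (move i (unmatchedSet i B)) (indexedFrom 1 B)
  eStar≡map-move i B = begin
    eStar i B                                           ≡⟨ eStar≡map-moveRow i B ⟩
    map (moveRow i B) (indexed B)                       ≡⟨ map-cong (moveRow≡move i B) (indexed B) ⟩
    map (move i (unmatchedSet i B)) (indexed B)         ≡⟨ cong (map (move i (unmatchedSet i B))) (indexed≡indexedFrom B) ⟩
    map (move i (unmatchedSet i B)) (indexedFrom 1 B)   ∎
    where open ≡-Reasoning

  unmatchedSet≡matchColumns : ∀ {n} i (B : Balls n) → unmatchedSet i B ≡ proj₁ (matchColumns (rowAt 1 B (suc i)) (rowAt 1 B i))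
  unmatchedSet≡matchColumns i B = cong proj₁ (unmatched≡matchColumns i B)

  move-other : ∀ {n} i (U : Subset n) r S → r ≢ suc i → r ≢ i → move i U (r , S) ≡ S
  move-other i U r S r≢1+i r≢i with r ≟ suc i
  ... | yes r≡1+i = ⊥-elim (r≢1+i r≡1+i)
  ... | no _ with r ≟ i
  ...   | yes r≡i = ⊥-elim (r≢i r≡i)
  ...   | no _    = refl

  move-suc : ∀ {n} i (U : Subset n) r S → move (suc i) U (suc r , S) ≡ move i U (r , S)
  move-suc i U r S with suc r ≟ suc (suc i) | r ≟ suc i
  ... | yes _  | yes _  = refl
  ... | yes eq | no ne  = ⊥-elim (ne (suc-injective eq))
  ... | no ne  | yes eq = ⊥-elim (ne (cong suc eq))
  ... | no _   | no _ with suc r ≟ suc i | r ≟ i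
  ...   | yes _  | yes _  = refl
  ...   | yes eq | no ne  = ⊥-elim (ne (suc-injective eq))
  ...   | no ne  | yes eq = ⊥-elim (ne (cong suc eq))
  ...   | no _   | no _   = refl

  map-move-suc : ∀ {n} i (U : Subset n) k B → map (move (suc i) U) (indexedFrom (suc k) B) ≡ map (move i U) (indexedFrom k B)
  map-move-suc i U k []      = refl
  map-move-suc i U k (S ∷ B) = cong₂ _∷_ (move-suc i U k S) (map-move-suc i U (suc k) B)

  map-move-above : ∀ {n} i (U : Subset n) k B → suc i < k → map (move i U) (indexedFrom k B) ≡ B
  map-move-above i U k []      _     = refl
  map-move-above i U k (S ∷ B) 1+i<k =
    cong₂ _∷_ (move-other i U k S (λ k≡1+i → <-irrefl (sym k≡1+i) 1+i<k) (λ k≡i → <-irrefl (sym k≡i) (<-trans (n<1+n i) 1+i<k)))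
              (map-move-above i U (suc k) B (m<n⇒m<1+n 1+i<k))

  rowAt-∷ : ∀ {n} r (D : Subset n) B → rowAt 1 (D ∷ B) (suc (suc r)) ≡ rowAt 1 B (suc r)
  rowAt-∷ r D B = trans (rowAt-miss 1 (suc (suc r)) D B (1+n≢0 ∘ suc-injective)) (rowAt-shift 1 (suc r) B)

  eStar-∷ : ∀ {n} i (D : Subset n) B → eStar (suc (suc i)) (D ∷ B) ≡ D ∷ eStar (suc i) B
  eStar-∷ i D B = begin
    eStar (suc (suc i)) (D ∷ B)                                    ≡⟨ eStar≡map-move (suc (suc i)) (D ∷ B) ⟩
    move (suc (suc i)) U′ (1 , D) ∷ map (move (suc (suc i)) U′) (indexedFrom 2 B)
      ≡⟨ cong₂ _∷_ (move-other (suc (suc i)) U′ 1 D (1+n≢0 ∘ sym ∘ suc-injective) (1+n≢0 ∘ sym ∘ suc-injective))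
                   (cong (λ V → map (move (suc (suc i)) V) (indexedFrom 2 B)) same-unmatched) ⟩
    D ∷ map (move (suc (suc i)) U) (indexedFrom 2 B)              ≡⟨ cong (D ∷_) (map-move-suc (suc i) U 1 B) ⟩
    D ∷ map (move (suc i) U) (indexedFrom 1 B)                    ≡⟨ cong (D ∷_) (eStar≡map-move (suc i) B) ⟨
    D ∷ eStar (suc i) B                                           ∎
    where
    open ≡-Reasoning
    U′ = unmatchedSet (suc (suc i)) (D ∷ B)
    U  = unmatchedSet (suc i) B
    same-unmatched : U′ ≡ U
    same-unmatched = begin
      U′                                                                        ≡⟨ unmatchedSet≡matchColumns (suc (suc i)) (D ∷ B) ⟩
      proj₁ (matchColumns (rowAt 1 (D ∷ B) (3 + i)) (rowAt 1 (D ∷ B) (2 + i)))  ≡⟨ cong₂ (λ Y D′ → proj₁ (matchColumns Y D′)) (rowAt-∷ (suc i) D B) (rowAt-∷ i D B) ⟩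
      proj₁ (matchColumns (rowAt 1 B (2 + i)) (rowAt 1 B (suc i)))              ≡⟨ unmatchedSet≡matchColumns (suc i) B ⟨
      U                                                                         ∎

  eStar-1 : ∀ {n} (D Y : Subset n) R → eStar 1 (D ∷ Y ∷ R) ≡ (D ∪ proj₁ (matchColumns Y D)) ∷ (Y ∩ ∁ (proj₁ (matchColumns Y D))) ∷ R
  eStar-1 D Y R = trans (eStar≡map-move 1 (D ∷ Y ∷ R))
    (cong₂ (λ U R′ → (D ∪ U) ∷ (Y ∩ ∁ U) ∷ R′) (unmatchedSet≡matchColumns 1 (D ∷ Y ∷ R)) (map-move-above 1 _ 3 R ≤-refl))

  rowAt-∷ʳ : ∀ {n} k (B : Balls n) S r → r < k + length B → rowAt k (B ∷ʳ S) r ≡ rowAt k B r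
  rowAt-∷ʳ k []       S r r<k+0 = rowAt-miss k r S [] (λ r≡k → <-irrefl r≡k (subst (r <_) (+-identityʳ k) r<k+0))
  rowAt-∷ʳ k (S′ ∷ B) S r r<    with r ≟ k
  ... | yes _ = refl
  ... | no _  = rowAt-∷ʳ (suc k) B S r (subst (r <_) (+-suc k (length B)) r<)

  indexedFrom-∷ʳ : ∀ {X : Set} k (B : List X) S → indexedFrom k (B ∷ʳ S) ≡ indexedFrom k B ∷ʳ (k + length B , S)
  indexedFrom-∷ʳ k []       S = cong (λ z → (z , S) ∷ []) (sym (+-identityʳ k))
  indexedFrom-∷ʳ k (S′ ∷ B) S = cong ((k , S′) ∷_) (trans (indexedFrom-∷ʳ (suc k) B S)
                                                          (cong (λ z → indexedFrom (suc k) B ∷ʳ (z , S)) (sym (+-suc k (length B)))))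

  eStar-∷ʳ : ∀ {n} i (B : Balls n) S → suc i ≤ length B → eStar i (B ∷ʳ S) ≡ eStar i B ∷ʳ S
  eStar-∷ʳ i B S i<len = begin
    eStar i (B ∷ʳ S)                                              ≡⟨ eStar≡map-move i (B ∷ʳ S) ⟩
    map (move i U′) (indexedFrom 1 (B ∷ʳ S))                      ≡⟨ cong₂ (λ V I → map (move i V) I) same-unmatched (indexedFrom-∷ʳ 1 B S) ⟩
    map (move i U) (indexedFrom 1 B ∷ʳ (suc (length B) , S))      ≡⟨ map-++ (move i U) (indexedFrom 1 B) ((suc (length B) , S) ∷ []) ⟩
    map (move i U) (indexedFrom 1 B) ∷ʳ move i U (suc (length B) , S)
      ≡⟨ cong₂ _∷ʳ_ (sym (eStar≡map-move i B)) (move-other i U (suc (length B)) S (λ eq → 1+n≰n (subst (suc i ≤_) (suc-injective eq) i<len))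
                                                                        (λ eq → 1+n≰n (≤-trans (n≤1+n _) (subst (λ z → suc z ≤ length B) (sym eq) i<len)))) ⟩
    eStar i B ∷ʳ S                                                ∎
    where
    open ≡-Reasoning
    U′ = unmatchedSet i (B ∷ʳ S)
    U  = unmatchedSet i B
    same-unmatched : U′ ≡ U
    same-unmatched = begin
      U′                                                               ≡⟨ unmatchedSet≡matchColumns i (B ∷ʳ S) ⟩
      proj₁ (matchColumns (rowAt 1 (B ∷ʳ S) (suc i)) (rowAt 1 (B ∷ʳ S) i))
        ≡⟨ cong₂ (λ Y D → proj₁ (matchColumns Y D)) (rowAt-∷ʳ 1 B S (suc i) (s≤s i<len)) (rowAt-∷ʳ 1 B S i (s≤s (≤-trans (n≤1+n i) i<len))) ⟩
      proj₁ (matchColumns (rowAt 1 B (suc i)) (rowAt 1 B i))           ≡⟨ unmatchedSet≡matchColumns i B ⟨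
      U                                                                ∎

  length-indexedFrom : ∀ {X : Set} k (B : List X) → length (indexedFrom k B) ≡ length B
  length-indexedFrom k []      = refl
  length-indexedFrom k (S ∷ B) = cong suc (length-indexedFrom (suc k) B)

  length-eStar : ∀ {n} i (B : Balls n) → length (eStar i B) ≡ length B
  length-eStar i B = trans (cong length (eStar≡map-move i B)) (trans (length-map _ (indexedFrom 1 B)) (length-indexedFrom 1 B))

  length-eInterval : ∀ {n} m (B : Balls n) → length (eInterval m B) ≡ length B
  length-eInterval zero    B = refl
  length-eInterval (suc m) B = trans (length-eInterval m (eStar (suc m) B)) (length-eStar (suc m) B)

  eInterval-∷ : ∀ {n} m (D : Subset n) B → eInterval (suc m) (D ∷ B) ≡ eStar 1 (D ∷ eInterval m B)
  eInterval-∷ zero    D B = refl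
  eInterval-∷ (suc m) D B = trans (cong (eInterval (suc m)) (eStar-∷ m D B)) (eInterval-∷ m D (eStar (suc m) B))

  eInterval-∷ʳ : ∀ {n} m (B : Balls n) S → m < length B → eInterval m (B ∷ʳ S) ≡ eInterval m B ∷ʳ S
  eInterval-∷ʳ zero    B S _     = refl
  eInterval-∷ʳ (suc m) B S m<len = trans (cong (eInterval m) (eStar-∷ʳ (suc m) B S m<len))
    (eInterval-∷ʳ m (eStar (suc m) B) S (subst (m <_) (sym (length-eStar (suc m) B)) (<-trans (n<1+n m) m<len)))

  eInterval≡sweep : ∀ {n} (T : List (Subset n)) x → HighestWeight T → x ≤ n → eInterval (length T) (T ∷ʳ ⟦ x ⟧) ≡ sweep T ⟦ x ⟧
  eInterval≡sweep []      x hw x≤n = refl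
  eInterval≡sweep (D ∷ T) x hw x≤n = begin
    eInterval (suc (length T)) (D ∷ (T ∷ʳ ⟦ x ⟧))                 ≡⟨ eInterval-∷ (length T) D (T ∷ʳ ⟦ x ⟧) ⟩
    eStar 1 (D ∷ eInterval (length T) (T ∷ʳ ⟦ x ⟧))              ≡⟨ cong (λ Z → eStar 1 (D ∷ Z)) (trans (eInterval≡sweep T x (Linked.tail hw) x≤n) shape) ⟩
    eStar 1 (D ∷ bottom ∷ rest)                                   ≡⟨ eStar-1 D bottom rest ⟩
    (D ∪ proj₁ (matchColumns bottom D)) ∷ (bottom ∩ ∁ (proj₁ (matchColumns bottom D))) ∷ rest
      ≡⟨ cong (λ U → (D ∪ U) ∷ (bottom ∩ ∁ U) ∷ rest) (matchColumns≡violation bottom D (bottom≼⁺ hw S)) ⟩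
    moveDown D (bottom ∷ rest)                                    ≡⟨ cong (moveDown D) shape ⟨
    sweep (D ∷ T) ⟦ x ⟧                                           ∎
    where
    open ≡-Reasoning
    S = sweep-shape T x (Linked.tail hw) x≤n
    open SweepShape S

  applyInterval : ∀ {n} → Balls n → ℕ → Balls n
  applyInterval C m = eInterval m C

  length-foldl-eInterval : ∀ {n} (L : List ℕ) (B : Balls n) → length (foldl applyInterval B L) ≡ length B
  length-foldl-eInterval []      B = refl
  length-foldl-eInterval (m ∷ L) B = trans (length-foldl-eInterval L (eInterval m B)) (length-eInterval m B)

  foldl-eInterval-∷ʳ : ∀ {n} (L : List ℕ) (B : Balls n) S → All (_< length B) L →
                       foldl applyInterval (B ∷ʳ S) L ≡ foldl applyInterval B L ∷ʳ S
  foldl-eInterval-∷ʳ []      B S []             = refl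
  foldl-eInterval-∷ʳ (m ∷ L) B S (m<len ∷ L<len) =
    trans (cong (λ Z → foldl applyInterval Z L) (eInterval-∷ʳ m B S m<len))
          (foldl-eInterval-∷ʳ L (eInterval m B) S (subst (λ z → All (_< z) L) (sym (length-eInterval m B)) L<len))

  ρN-∷ʳ : ∀ {n} (B : Balls n) X → ρN (B ∷ʳ X) ≡ eInterval (length B) (ρN B ∷ʳ X)
  ρN-∷ʳ []      X = refl
  ρN-∷ʳ (D ∷ B) X = begin
    foldl applyInterval ((D ∷ B) ∷ʳ X) (map suc (upTo (length (B ∷ʳ X))))
      ≡⟨ cong (λ z → foldl applyInterval ((D ∷ B) ∷ʳ X) (map suc (upTo z))) (trans (length-++ B) (+-comm k 1)) ⟩
    foldl applyInterval ((D ∷ B) ∷ʳ X) (map suc (upTo (suc k)))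
      ≡⟨ cong (foldl applyInterval ((D ∷ B) ∷ʳ X) ∘ map suc) (upTo-∷ʳ k) ⟨
    foldl applyInterval ((D ∷ B) ∷ʳ X) (map suc (upTo k ∷ʳ k))
      ≡⟨ cong (foldl applyInterval ((D ∷ B) ∷ʳ X)) (map-++ suc (upTo k) (k ∷ [])) ⟩
    foldl applyInterval ((D ∷ B) ∷ʳ X) (map suc (upTo k) ∷ʳ suc k)
      ≡⟨ foldl-∷ʳ applyInterval ((D ∷ B) ∷ʳ X) (suc k) (map suc (upTo k)) ⟩
    eInterval (suc k) (foldl applyInterval ((D ∷ B) ∷ʳ X) (map suc (upTo k)))
      ≡⟨ cong (eInterval (suc k)) (foldl-eInterval-∷ʳ (map suc (upTo k)) (D ∷ B) X (All.map⁺ (All.applyUpTo⁺₁ id k s≤s))) ⟩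
    eInterval (suc k) (ρN (D ∷ B) ∷ʳ X)
      ∎
    where
    open ≡-Reasoning
    k = length B

  length-ρN : ∀ {n} (B : Balls n) → length (ρN B) ≡ length B
  length-ρN B = length-foldl-eInterval (map suc (upTo (length B ∸ 1))) B

  ρ-∷ʳ : ∀ {n} (w : List (Fin n)) x → ρ (w ∷ʳ x) ≡ eInterval (length (ρ w)) (ρ w ∷ʳ ⁅ x ⁆)
  ρ-∷ʳ w x = begin
    ρN (map ⁅_⁆ (w ∷ʳ x))                                       ≡⟨ cong ρN (map-++ ⁅_⁆ w (x ∷ [])) ⟩
    ρN (map ⁅_⁆ w ∷ʳ ⁅ x ⁆)                                     ≡⟨ ρN-∷ʳ (map ⁅_⁆ w) ⁅ x ⁆ ⟩
    eInterval (length (map ⁅_⁆ w)) (ρ w ∷ʳ ⁅ x ⁆)               ≡⟨ cong (λ z → eInterval z (ρ w ∷ʳ ⁅ x ⁆)) (length-ρN (map ⁅_⁆ w)) ⟨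
    eInterval (length (ρ w)) (ρ w ∷ʳ ⁅ x ⁆)                     ∎
    where open ≡-Reasoning

  letter : ∀ {n} → Fin n → ℕ
  letter x = suc (toℕ x)

  ⁅⁆≡⟦letter⟧ : ∀ {n} (x : Fin n) → ⁅ x ⁆ ≡ ⟦ letter x ⟧
  ⁅⁆≡⟦letter⟧ {suc n} zero    = refl
  ⁅⁆≡⟦letter⟧ {suc n} (suc x) = cong (false ∷_) (⁅⁆≡⟦letter⟧ x)

  sweepWord : ∀ {n} → List (Subset n) → List (Fin n) → List (Subset n)
  sweepWord = foldl (λ T x → sweep T ⟦ letter x ⟧)

  sweepWord-highestWeight : ∀ {n} (T : List (Subset n)) w → HighestWeight T → HighestWeight (sweepWord T w)
  sweepWord-highestWeight T []      hw = hw
  sweepWord-highestWeight T (x ∷ w) hw =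
    sweepWord-highestWeight (sweep T ⟦ letter x ⟧) w (sweep-highestWeight T (letter x) hw (toℕ<n x))

  ρ≡sweepWord : ∀ {n} (w : List (Fin n)) → ρ w ≡ sweepWord [] w
  ρ≡sweepWord w = go (reverseView w)
    where
    go : ∀ {w} → Reverse w → ρ w ≡ sweepWord [] w
    go []            = refl
    go (w ∶ rw ∶ʳ x) = begin
      ρ (w ∷ʳ x)                                                            ≡⟨ ρ-∷ʳ w x ⟩
      eInterval (length (ρ w)) (ρ w ∷ʳ ⁅ x ⁆)                               ≡⟨ cong₂ (λ T X → eInterval (length T) (T ∷ʳ X)) (go rw) (⁅⁆≡⟦letter⟧ x) ⟩
      eInterval (length (sweepWord [] w)) (sweepWord [] w ∷ʳ ⟦ letter x ⟧)  ≡⟨ eInterval≡sweep (sweepWord [] w) (letter x) (sweepWord-highestWeight [] w []) (toℕ<n x) ⟩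
      sweep (sweepWord [] w) ⟦ letter x ⟧                                   ≡⟨ foldl-∷ʳ (λ T y → sweep T ⟦ letter y ⟧) [] x w ⟨
      sweepWord [] (w ∷ʳ x)                                                 ∎
      where open ≡-Reasoning

module KnuthInvariance where

  open RowInsertion
  open Sweep
  open Tableau
  open CrystalOperators

  reverse-middle : ∀ {A : Set} (u v : List A) x y z → reverse (u ++ x ∷ y ∷ z ∷ v) ≡ reverse v ++ z ∷ y ∷ x ∷ reverse u
  reverse-middle u v x y z = begin
    reverse (u ++ x ∷ y ∷ z ∷ v)                  ≡⟨ reverse-++ u (x ∷ y ∷ z ∷ v) ⟩
    reverse (x ∷ y ∷ z ∷ v) ++ reverse u          ≡⟨ cong (_++ reverse u) (reverse-++ (x ∷ y ∷ z ∷ []) v) ⟩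
    (reverse v ++ z ∷ y ∷ x ∷ []) ++ reverse u    ≡⟨ ++-assoc (reverse v) (z ∷ y ∷ x ∷ []) (reverse u) ⟩
    reverse v ++ z ∷ y ∷ x ∷ reverse u            ∎
    where open ≡-Reasoning

  letters : ∀ {n} → Fin n → Fin n → Fin n → Triple
  letters x y z = letter x , letter y , letter z

  ρ-reverse-middle : ∀ {n} (u v : List (Fin n)) x y z →
                     ρ (reverse (u ++ x ∷ y ∷ z ∷ v)) ≡ sweepWord (sweep3 (sweepWord [] (reverse v)) (letters z y x)) (reverse u)
  ρ-reverse-middle u v x y z = begin
    ρ (reverse (u ++ x ∷ y ∷ z ∷ v))                                ≡⟨ cong ρ (reverse-middle u v x y z) ⟩
    ρ (reverse v ++ z ∷ y ∷ x ∷ reverse u)                          ≡⟨ ρ≡sweepWord (reverse v ++ z ∷ y ∷ x ∷ reverse u) ⟩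
    sweepWord [] (reverse v ++ z ∷ y ∷ x ∷ reverse u)               ≡⟨ foldl-++ _ [] (reverse v) (z ∷ y ∷ x ∷ reverse u) ⟩
    sweepWord (sweep3 (sweepWord [] (reverse v)) (letters z y x)) (reverse u) ∎
    where open ≡-Reasoning

  ρ-reverse-middle-knuth : ∀ {n} (u v : List (Fin n)) x y z x′ y′ z′ → Knuth3 (letters z y x) (letters z′ y′ x′) →
                           ρ (reverse (u ++ x ∷ y ∷ z ∷ v)) ≡ ρ (reverse (u ++ x′ ∷ y′ ∷ z′ ∷ v))
  ρ-reverse-middle-knuth u v x y z x′ y′ z′ knuth = begin
    ρ (reverse (u ++ x ∷ y ∷ z ∷ v))                      ≡⟨ ρ-reverse-middle u v x y z ⟩
    sweepWord (sweep3 T (letters z y x)) (reverse u)      ≡⟨ cong (λ T′ → sweepWord T′ (reverse u))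
                                                               (sweep3-knuth T _ _ hw (bounds z y x) (bounds z′ y′ x′) knuth) ⟩
    sweepWord (sweep3 T (letters z′ y′ x′)) (reverse u)   ≡⟨ ρ-reverse-middle u v x′ y′ z′ ⟨
    ρ (reverse (u ++ x′ ∷ y′ ∷ z′ ∷ v))                   ∎
    where
    open ≡-Reasoning
    T = sweepWord [] (reverse v)
    hw = sweepWord-highestWeight [] (reverse v) []
    bounds : ∀ a b c → Triple≤ (letters a b c) _
    bounds a b c = toℕ<n a , toℕ<n b , toℕ<n c

  ρ-reverse-knuthStep : ∀ {n} {p q : List (Fin n)} → KnuthStep p q → ρ (reverse p) ≡ ρ (reverse q)
  ρ-reverse-knuthStep (kbac u v a b c a<b b≤c) = ρ-reverse-middle-knuth u v b a c b c a (fwd (cab-acb (inj₁ (s≤s a<b)) (s≤s b≤c)))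
  ρ-reverse-knuthStep (kacb u v a b c a≤b b<c) = ρ-reverse-middle-knuth u v a c b c a b (fwd (bca-bac (s≤s a≤b) (s≤s b<c)))

open KnuthInvariance using (ρ-reverse-knuthStep)

lemmaA8 : (n : ℕ) (w w' : List (Fin n)) →
          KnuthEquiv (reverse w) (reverse w') →
          stripTrailing (ρ w) ≡ stripTrailing (ρ w')
lemmaA8 n w w′ knuth = cong stripTrailing (begin
  ρ w                        ≡⟨ cong ρ (reverse-involutive w) ⟨
  ρ (reverse (reverse w))    ≡⟨ EqClosure.gfold isEquivalence (ρ ∘ reverse) ρ-reverse-knuthStep knuth ⟩
  ρ (reverse (reverse w′))   ≡⟨ cong ρ (reverse-involutive w′) ⟩
  ρ w′                       ∎)
  where open ≡-Reasoning
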